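{- Let $k\ge2$ and $q\ge1$. Up to isomorphism of simplicial complexes, the links of the vertices of $T_{k,q}$ are exactly the complexes in $\bigcup_{s=1}^{q}\{K_\lambda\}_{\lambda\in Par(k,s)}$; that is, every vertex link is isomorphic to some $K_\lambda$ with $\lambda$ a partition of $k$ into $s\le q$ parts, and every such $K_\lambda$ occurs as the link of some vertex.
   Context: $R_{k,q}=\{\mathbf{x}\in\mathbb{R}^{k-1}:0\le x_1\le\cdots\le x_{k-1}\le q\}$, $W_{k,q}=R_{k,q}\cap\mathbb{Z}^{k-1}$. A permutation $\pi$ of $[k-1]$ is consistent with $\mathbf{v}\in W_{k,q}$ if $i$ precedes $i+1$ in $\pi$ whenever $v_i=v_{i+1}$; then $F(\mathbf{v},\pi)$ is the simplex with vertices $\mathbf{v}^{(1)}=\mathbf{v}$, $\mathbf{v}^{(m+1)}=\mathbf{v}^{(m)}+e_{\pi_{k-m}}$ ($m=1,\dots,k-1$). $T_{k,q}$ is the simplicial complex on $W_{k,q}$ whose facets are all such $F(\mathbf{v},\pi)$; $\mathrm{link}_K(\sigma)=\{\tau\in K:\sigma\cup\tau\in K,\sigma\cap\tau=\emptyset\}$. $Par(k,s)$ is the set of partitions of $k$ into exactly $s$ positive parts. For a partition $\lambda=(\lambda_1,\ldots,\lambda_s)$, $P_\lambda=C_{\lambda_1}\times\cdots\times C_{\lambda_s}$ where $C_m$ is the chain $0<1<\cdots<m$, and $K_\lambda=\Delta(P_\lambda\setminus\{\hat0,\hat1\})$, the order complex of $P_\lambda$ with its minimum and maximum removed. -}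

module Defs where

open import Level using (0ℓ)
open import Data.Nat using (ℕ; zero; suc; _≤_; _<_; _∸_)
open import Data.Fin using (Fin; toℕ; opposite) renaming (_<_ to _<ᶠ_)
open import Data.Fin.Permutation using (Permutation′; _⟨$⟩ʳ_; _⟨$⟩ˡ_)
open import Data.Vec using (Vec; lookup; _[_]%=_; replicate; sum)
open import Data.List using (List; []; _∷_; map; scanl; allFin)
open import Data.List.Membership.Propositional using (_∈_; _∉_)
open import Data.List.Relation.Binary.Subset.Propositional using (_⊆_)
open import Data.List.Relation.Unary.All using (All)
open import Data.Product using (Σ; _×_; ∃)
open import Data.Sum using (_⊎_)
open import Relation.Binary.PropositionalEquality using (_≡_; _≢_)
open import Function.Bundles using (_⇔_)

-- A complex is given by an ambient type of (potential) vertices and a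
-- predicate on finite lists of them; a list is read as the SET of its
-- elements (all concrete complexes below only look at membership).

record Complex : Set₁ where
  field
    Carrier : Set
    Face    : List Carrier → Set

open Complex public

Vertex : (K : Complex) → Carrier K → Set
Vertex K a = Face K (a ∷ [])

record _≅_ (K L : Complex) : Set where
  field
    to        : Carrier K → Carrier L
    from      : Carrier L → Carrier K
    to-vert   : ∀ a → Vertex K a → Vertex L (to a)
    from-vert : ∀ b → Vertex L b → Vertex K (from b)
    from-to   : ∀ a → Vertex K a → from (to a) ≡ a
    to-from   : ∀ b → Vertex L b → to (from b) ≡ b
    face-iff  : ∀ σ → All (Vertex K) σ → (Face K σ ⇔ Face L (map to σ))

link : (K : Complex) → Carrier K → Complex
link K v = record
  { Carrier = Carrier K
  ; Face    = λ τ → (v ∉ τ) × Face K (v ∷ τ)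
  }

-- The complex T_{k,q}.  Points of ℝ^{k-1} with integer coordinates are
-- Vec ℕ (k ∸ 1); coordinate i (1-based) is lookup at index i-1.

Succ : ∀ {n} → Fin n → Fin n → Set
Succ i j = toℕ j ≡ suc (toℕ i)

InW : ∀ {n} → ℕ → Vec ℕ n → Set
InW q v = (∀ i j → Succ i j → lookup v i ≤ lookup v j) × (∀ i → lookup v i ≤ q)

-- π consistent with v: i precedes i+1 in π (π = (π_1,…,π_{k-1}), the
-- position of a value x is π⁻¹ x) whenever v_i = v_{i+1}.
Consistent : ∀ {n} → Vec ℕ n → Permutation′ n → Set
Consistent v π = ∀ i j → Succ i j → lookup v i ≡ lookup v j →
                 (π ⟨$⟩ˡ i) <ᶠ (π ⟨$⟩ˡ j)

addE : ∀ {n} → Vec ℕ n → Fin n → Vec ℕ n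
addE w i = w [ i ]%= suc

-- vertices v^(1), …, v^(k) of F(v,π):  v^(1) = v,
-- v^(m+1) = v^(m) + e_{π_{k-m}}, m = 1..k-1.  With 0-based position
-- t = m-1 ∈ Fin (k-1), π_{k-m} is the entry at 0-based position
-- (k-2) - t = opposite t.
simplexVerts : ∀ {n} → Vec ℕ n → Permutation′ n → List (Vec ℕ n)
simplexVerts {n} v π = scanl addE v (map (λ t → π ⟨$⟩ʳ opposite t) (allFin n))

T : (k q : ℕ) → Complex
T k q = record
  { Carrier = Vec ℕ (k ∸ 1)
  ; Face    = λ σ → Σ (Vec ℕ (k ∸ 1)) λ v → Σ (Permutation′ (k ∸ 1)) λ π →
                InW q v × Consistent v π × All (InW q) (simplexVerts v π)
                × σ ⊆ simplexVerts v π
  }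

sumV : ∀ {s} → Vec ℕ s → ℕ
sumV = sum

IsPar : (k s : ℕ) → Vec ℕ s → Set
IsPar k s lam = (∀ i j → Succ i j → lookup lam j ≤ lookup lam i)
              × (∀ i → 1 ≤ lookup lam i)
              × sumV lam ≡ k

-- P_λ = C_{λ_1} × … × C_{λ_s}, componentwise order.
InP : ∀ {s} → Vec ℕ s → Vec ℕ s → Set
InP lam a = ∀ i → lookup a i ≤ lookup lam i

_≤P_ : ∀ {s} → Vec ℕ s → Vec ℕ s → Set
a ≤P b = ∀ i → lookup a i ≤ lookup b i

InP° : ∀ {s} → Vec ℕ s → Vec ℕ s → Set
InP° {s} lam a = InP lam a × a ≢ replicate s 0 × a ≢ lam

K : (s : ℕ) → Vec ℕ s → Complex
K s lam = record
  { Carrier = Vec ℕ s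
  ; Face    = λ σ → All (InP° lam) σ
                  × (∀ {a b} → a ∈ σ → b ∈ σ → (a ≤P b) ⊎ (b ≤P a))
  }

{-# OPTIONS --safe #-}
-- Pad v to the sequence 0, v₁, …, v_{k−1}, q and index its k gaps cyclically.
-- Walking around a simplex F(w, π) crosses each gap once, so a neighbour u of v
-- is v + e_S − [0 ∈ S] for a proper nonempty set S of gaps, and the faces
-- through v are exactly the chains of such sets; u stays in W_{k,q} iff S is
-- closed under stepping over the zero gaps of v.  Cutting the cycle after a
-- positive gap, the zero gaps glue the k positions into s blocks, where s is
-- the number of positive gaps, so 1 ≤ s ≤ q.  A closed set meets each block in
-- a final segment, so closed sets under inclusion form C_{λ₁} × ⋯ × C_{λₛ} for
-- the block sizes λ, and the link is K_λ; sorting λ gives a partition of k.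
-- Conversely, gaps 1, …, 1, q − s + 1 placed at the ends of blocks of sizes λ
-- realise every partition with s ≤ q parts.
module Submission where

open import Defs
open import Data.Nat using (ℕ; _≤_; _∸_)
open import Data.Vec using (Vec)
open import Data.Product using (Σ; _×_)

open import Data.Bool using (Bool; true; false; not)
open import Data.Bool.Properties using () renaming (_≟_ to _≟ᵇ_)
open import Data.Empty using (⊥; ⊥-elim)
open import Data.Fin using (Fin; zero; suc; toℕ; fromℕ; fromℕ<; inject₁; opposite; punchOut)
open import Data.Fin.Permutation
  using (Permutation′; _⟨$⟩ʳ_; _⟨$⟩ˡ_; permutation; inverseˡ; inverseʳ; flip; _∘ₚ_; lift₀; transpose)
import Data.Fin.Permutation as Perm
open import Data.Fin.Properties
  using (toℕ-injective; toℕ<n; toℕ-fromℕ<; toℕ-fromℕ; toℕ-inject₁; fromℕ<-toℕ; opposite-involutive; opposite-prop;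
         any?; all?; ¬∀⟶∃¬; injective⇒≤; punchOut-injective)
  renaming (_≟_ to _≟ᶠ_; suc-injective to Fin-suc-injective)
open import Data.Fin.Subset using (∣_∣) renaming (_⊆_ to _⊆ˢ_)
open import Data.Fin.Subset.Properties using (∣p∣≤n; p⊆q⇒∣p∣≤∣q∣; p⊂q⇒∣p∣<∣q∣)
open import Data.List using (List; []; _∷_; applyUpTo; scanl)
import Data.List as List
open import Data.List.Membership.Propositional using (_∈_; _∉_)
open import Data.List.Membership.Propositional.Properties using (∈-applyUpTo⁺; ∈-applyUpTo⁻; ∈-map⁺; ∈-map⁻)
open import Data.List.Properties using (map-tabulate; map-∘)
open import Data.List.Relation.Binary.Subset.Propositional using (_⊆_)
open import Data.List.Relation.Unary.All as All using (All)
open import Data.List.Relation.Unary.All.Properties using (applyUpTo⁺₁; map⁺)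
open import Data.List.Relation.Unary.Any using (here; there)
open import Data.Nat using (zero; suc; _+_; _*_; _<_; _≥_; z≤n; s≤s; s≤s⁻¹; _<ᵇ_; _≡ᵇ_; _⊓_)
open import Data.Nat.DivMod using (_%_; m%n<n; m%n%n≡m%n; %-distribˡ-+; [m+n]%n≡m%n; m≤n⇒m%n≡m; n%n≡0)
open import Data.Nat.Properties
open import Data.Product using (∃; _,_; proj₁; proj₂)
open import Data.Sum using (_⊎_; inj₁; inj₂)
import Data.Sum as Sum
open import Data.Vec using ([]; _∷_; head; lookup; tabulate; replicate; sum; _++_)
open import Data.Vec.Properties
  using (lookup∘tabulate; tabulate∘lookup; tabulate-cong; lookup-replicate; lookup∘updateAt; lookup∘updateAt′;
         []=⇒lookup; lookup⇒[]=)
open import Data.Vec.Relation.Unary.Linked using (Linked; []; [-]; _∷_)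
import Data.Vec.Relation.Unary.Linked.Properties as Linked
open import Function using (_∘_)
open import Function.Bundles using (mk⇔; Equivalence)
open import Function.Definitions using (Injective)
open import Relation.Binary.Definitions using (tri<; tri≈; tri>)
open import Relation.Binary.PropositionalEquality
open import Relation.Nullary using (¬_; yes; no; does)
open import Relation.Nullary.Decidable using (dec-true; dec-false)

bit : Bool → ℕ
bit true  = 1
bit false = 0

bit≤1 : ∀ b → bit b ≤ 1
bit≤1 true  = ≤-refl
bit≤1 false = z≤n

_⊆ᵇ_ : {A : Set} → (A → Bool) → (A → Bool) → Set
S ⊆ᵇ S′ = ∀ x → S x ≡ true → S′ x ≡ true

bit-mono : ∀ {a b} → (a ≡ true → b ≡ true) → bit a ≤ bit b
bit-mono {false} _ = z≤n
bit-mono {true}  h rewrite h refl = ≤-refl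

bit-injective : ∀ {a b} → bit a ≡ bit b → a ≡ b
bit-injective {false} {false} _ = refl
bit-injective {true}  {true}  _ = refl

true≢false : true ≢ false
true≢false ()

<ᵇ-true : ∀ {x y} → x < y → (x <ᵇ y) ≡ true
<ᵇ-true {zero}  (s≤s _) = refl
<ᵇ-true {suc x} (s≤s p) = <ᵇ-true p

<ᵇ-false : ∀ {x y} → y ≤ x → (x <ᵇ y) ≡ false
<ᵇ-false {x}     {zero}  _       = refl
<ᵇ-false {suc x} {suc y} (s≤s p) = <ᵇ-false p

<ᵇ-true⁻¹ : ∀ x y → (x <ᵇ y) ≡ true → x < y
<ᵇ-true⁻¹ zero    (suc y) _ = s≤s z≤n
<ᵇ-true⁻¹ (suc x) (suc y) p = s≤s (<ᵇ-true⁻¹ x y p)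

<ᵇ-mono : ∀ h {x y} → x ≤ y → (h <ᵇ x) ≡ true → (h <ᵇ y) ≡ true
<ᵇ-mono h {x} x≤y h<x = <ᵇ-true (≤-trans (<ᵇ-true⁻¹ h x h<x) x≤y)

<⊎≥ : ∀ a b → a < b ⊎ b ≤ a
<⊎≥ a b with a <? b
... | yes a<b = inj₁ a<b
... | no a≮b  = inj₂ (≮⇒≥ a≮b)

<ᵇ-iff : ∀ {x y x′ y′} → (x < y → x′ < y′) → (x′ < y′ → x < y) → (x <ᵇ y) ≡ (x′ <ᵇ y′)
<ᵇ-iff {x} {y} f g with x <? y
... | yes x<y = trans (<ᵇ-true x<y) (sym (<ᵇ-true (f x<y)))
... | no x≮y  = trans (<ᵇ-false (≮⇒≥ x≮y)) (sym (<ᵇ-false (≮⇒≥ (x≮y ∘ g))))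

fromℕ⊎inject₁ : ∀ {n} (t : Fin (suc n)) → t ≡ fromℕ n ⊎ ∃ λ t′ → t ≡ inject₁ t′
fromℕ⊎inject₁ {zero}  zero    = inj₁ refl
fromℕ⊎inject₁ {suc n} zero    = inj₂ (zero , refl)
fromℕ⊎inject₁ {suc n} (suc t) with fromℕ⊎inject₁ t
... | inj₁ eq        = inj₁ (cong suc eq)
... | inj₂ (t′ , eq) = inj₂ (suc t′ , cong suc eq)

lookup-ext : ∀ {A : Set} {n} (x y : Vec A n) → (∀ i → lookup x i ≡ lookup y i) → x ≡ y
lookup-ext x y h = trans (sym (tabulate∘lookup x)) (trans (tabulate-cong h) (tabulate∘lookup y))

-- Blocks of a glue pattern

-- A glue pattern g : Vec Bool n glues position t of the row 0, …, n to
-- position t + 1 when g t is true; its blocks are the maximal glued runs.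
-- A set of positions closed under glued steps meets every block in a final
-- segment, so it is determined by the lengths of these segments.

cuts : ∀ {n} → Vec Bool n → ℕ
cuts []          = 0
cuts (true ∷ g)  = cuts g
cuts (false ∷ g) = suc (cuts g)

addHead : ∀ {m} → ℕ → Vec ℕ (suc m) → Vec ℕ (suc m)
addHead x (y ∷ ys) = x + y ∷ ys

blockSizes : ∀ {n} (g : Vec Bool n) → Vec ℕ (suc (cuts g))
blockSizes []          = 1 ∷ []
blockSizes (true ∷ g)  = addHead 1 (blockSizes g)
blockSizes (false ∷ g) = 1 ∷ blockSizes g

UpClosed : ∀ {n} → Vec Bool n → Vec Bool (suc n) → Set
UpClosed {n} g X = ∀ (t : Fin n) → lookup g t ≡ true →
                   lookup X (inject₁ t) ≡ true → lookup X (suc t) ≡ true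

blockCounts : ∀ {n} (g : Vec Bool n) → Vec Bool (suc n) → Vec ℕ (suc (cuts g))
blockCounts []          (b ∷ []) = bit b ∷ []
blockCounts (true ∷ g)  (b ∷ X)  = addHead (bit b) (blockCounts g X)
blockCounts (false ∷ g) (b ∷ X)  = bit b ∷ blockCounts g X

finalSegments : ∀ {n} (g : Vec Bool n) → Vec ℕ (suc (cuts g)) → Vec Bool (suc n)
finalSegments []          (a ∷ []) = (0 <ᵇ a) ∷ []
finalSegments (false ∷ g) (a ∷ as) = (0 <ᵇ a) ∷ finalSegments g as
finalSegments (true ∷ g)  (a ∷ as) =
  (head (blockSizes g) <ᵇ a) ∷ finalSegments g (a ⊓ head (blockSizes g) ∷ as)

head-≤P : ∀ {m} (as bs : Vec ℕ (suc m)) → as ≤P bs → head as ≤ head bs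
head-≤P (_ ∷ _) (_ ∷ _) as≤bs = as≤bs zero

addHead-mono : ∀ {m x y} (as bs : Vec ℕ (suc m)) → x ≤ y → as ≤P bs → addHead x as ≤P addHead y bs
addHead-mono (_ ∷ _) (_ ∷ _) x≤y as≤bs zero    = +-mono-≤ x≤y (as≤bs zero)
addHead-mono (_ ∷ _) (_ ∷ _) x≤y as≤bs (suc i) = as≤bs (suc i)

≤P-addHead⁻ : ∀ {m} {x y} {as} (c : Vec ℕ (suc m)) → (x ∷ as) ≤P addHead y c →
              x ≤ y + head c × (∀ {x′} → x′ ≤ head c → (x′ ∷ as) ≤P c)
≤P-addHead⁻ (_ ∷ _) le = le zero , λ { x′≤z zero → x′≤z ; _ (suc i) → le (suc i) }

blockCounts-≤ : ∀ {n} (g : Vec Bool n) X → blockCounts g X ≤P blockSizes g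
blockCounts-≤ []          (b ∷ []) zero    = bit≤1 b
blockCounts-≤ (false ∷ g) (b ∷ X)  zero    = bit≤1 b
blockCounts-≤ (false ∷ g) (b ∷ X)  (suc i) = blockCounts-≤ g X i
blockCounts-≤ (true ∷ g)  (b ∷ X)  i       = addHead-mono (blockCounts g X) (blockSizes g) (bit≤1 b) (blockCounts-≤ g X) i

head-addHead : ∀ {m} x (as : Vec ℕ (suc m)) → head (addHead x as) ≡ x + head as
head-addHead x (_ ∷ _) = refl

blockCounts-head : ∀ {n} (g : Vec Bool n) X → UpClosed g X → lookup X zero ≡ true →
                   head (blockCounts g X) ≡ head (blockSizes g)
blockCounts-head []          (b ∷ [])        _  refl = refl
blockCounts-head (false ∷ g) (true ∷ X)      _  refl = refl
blockCounts-head (true ∷ g)  (true ∷ x ∷ X) up refl =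
  trans (head-addHead 1 (blockCounts g (x ∷ X)))
        (trans (cong suc (blockCounts-head g (x ∷ X) (λ t → up (suc t)) (up zero refl refl)))
               (sym (head-addHead 1 (blockSizes g))))

0<ᵇbit : ∀ b → (0 <ᵇ bit b) ≡ b
0<ᵇbit true  = refl
0<ᵇbit false = refl

-- The first position of a block is in the set iff the count exceeds the size
-- c of the rest of the block, since final segments containing it contain the rest.
split-first : ∀ b x c → x ≤ c → (b ≡ true → x ≡ c) →
              (c <ᵇ bit b + x) ≡ b × (bit b + x) ⊓ c ≡ x
split-first false x c x≤c _ = <ᵇ-false x≤c , m≤n⇒m⊓n≡m x≤c
split-first true  x c x≤c full rewrite full refl =
  <ᵇ-true (n<1+n c) , m≥n⇒m⊓n≡n (n≤1+n c)

finalSegments∘blockCounts : ∀ {n} (g : Vec Bool n) X → UpClosed g X →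
                            finalSegments g (blockCounts g X) ≡ X
finalSegments∘blockCounts []          (b ∷ []) _  = cong (_∷ []) (0<ᵇbit b)
finalSegments∘blockCounts (false ∷ g) (b ∷ X)  up =
  cong₂ _∷_ (0<ᵇbit b) (finalSegments∘blockCounts g X (λ t → up (suc t)))
finalSegments∘blockCounts (true ∷ g)  (b ∷ X)  up
  with blockCounts g X | head-≤P (blockCounts g X) (blockSizes g) (blockCounts-≤ g X)
     | blockCounts-head g X (λ t → up (suc t)) | finalSegments∘blockCounts g X (λ t → up (suc t))
... | x ∷ xs | x≤c | full | ih with split-first b x _ x≤c (λ b≡true → full (up zero refl b≡true))
... | first , rest = cong₂ _∷_ first (trans (cong (λ z → finalSegments g (z ∷ xs)) rest) ih)

bit-0<ᵇ : ∀ a → a ≤ 1 → bit (0 <ᵇ a) ≡ a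
bit-0<ᵇ zero          _ = refl
bit-0<ᵇ (suc zero)    _ = refl
bit-0<ᵇ (suc (suc a)) (s≤s ())

join-first : ∀ x c → x ≤ suc c → bit (c <ᵇ x) + x ⊓ c ≡ x
join-first x c x≤1+c with x ≤? c
... | yes x≤c = trans (cong (λ b → bit b + x ⊓ c) (<ᵇ-false x≤c)) (m≤n⇒m⊓n≡m x≤c)
... | no x≰c with ≤-antisym x≤1+c (≰⇒> x≰c)
...   | refl = trans (cong (λ b → bit b + suc c ⊓ c) (<ᵇ-true (n<1+n c))) (cong suc (m≥n⇒m⊓n≡n (n≤1+n c)))

blockCounts∘finalSegments : ∀ {n} (g : Vec Bool n) a → a ≤P blockSizes g →
                            blockCounts g (finalSegments g a) ≡ a
blockCounts∘finalSegments []          (a ∷ []) le = cong (_∷ []) (bit-0<ᵇ a (le zero))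
blockCounts∘finalSegments (false ∷ g) (a ∷ as) le =
  cong₂ _∷_ (bit-0<ᵇ a (le zero)) (blockCounts∘finalSegments g as (λ i → le (suc i)))
blockCounts∘finalSegments (true ∷ g)  (x ∷ as) le with ≤P-addHead⁻ (blockSizes g) le
... | x≤1+c , rest≤ =
  trans (cong (addHead (bit (c <ᵇ x))) (blockCounts∘finalSegments g _ (rest≤ (m⊓n≤n x c))))
        (cong (_∷ as) (join-first x c x≤1+c))
  where c = head (blockSizes g)

finalSegments-first : ∀ {n} (g : Vec Bool n) as → lookup (finalSegments g (head (blockSizes g) ∷ as)) zero ≡ true
finalSegments-first []          [] = refl
finalSegments-first (false ∷ g) as = refl
finalSegments-first (true ∷ g)  as with blockSizes g
... | c ∷ _ = <ᵇ-true (n<1+n c)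

finalSegments-upClosed : ∀ {n} (g : Vec Bool n) a → UpClosed g (finalSegments g a)
finalSegments-upClosed (false ∷ g) (a ∷ as) zero    ()
finalSegments-upClosed (false ∷ g) (a ∷ as) (suc t) = finalSegments-upClosed g as t
finalSegments-upClosed (true ∷ g)  (x ∷ as) zero    _ c<x =
  subst (λ z → lookup (finalSegments g (z ∷ as)) zero ≡ true)
        (sym (m≥n⇒m⊓n≡n (<⇒≤ (<ᵇ-true⁻¹ _ x c<x)))) (finalSegments-first g as)
finalSegments-upClosed (true ∷ g)  (x ∷ as) (suc t) = finalSegments-upClosed g _ t

blockCounts-mono : ∀ {n} (g : Vec Bool n) X Y → lookup X ⊆ᵇ lookup Y → blockCounts g X ≤P blockCounts g Y
blockCounts-mono []          (a ∷ []) (b ∷ []) X⊆Y zero    = bit-mono (X⊆Y zero)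
blockCounts-mono (false ∷ g) (a ∷ X)  (b ∷ Y)  X⊆Y zero    = bit-mono (X⊆Y zero)
blockCounts-mono (false ∷ g) (a ∷ X)  (b ∷ Y)  X⊆Y (suc i) = blockCounts-mono g X Y (λ j → X⊆Y (suc j)) i
blockCounts-mono (true ∷ g)  (a ∷ X)  (b ∷ Y)  X⊆Y =
  addHead-mono (blockCounts g X) (blockCounts g Y) (bit-mono (X⊆Y zero)) (blockCounts-mono g X Y (λ j → X⊆Y (suc j)))

finalSegments-mono : ∀ {n} (g : Vec Bool n) a b → a ≤P b → lookup (finalSegments g a) ⊆ᵇ lookup (finalSegments g b)
finalSegments-mono []          (x ∷ []) (y ∷ []) a≤b zero    = <ᵇ-mono 0 (a≤b zero)
finalSegments-mono (false ∷ g) (x ∷ as) (y ∷ bs) a≤b zero    = <ᵇ-mono 0 (a≤b zero)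
finalSegments-mono (false ∷ g) (x ∷ as) (y ∷ bs) a≤b (suc i) = finalSegments-mono g as bs (λ j → a≤b (suc j)) i
finalSegments-mono (true ∷ g)  (x ∷ as) (y ∷ bs) a≤b zero    = <ᵇ-mono (head (blockSizes g)) (a≤b zero)
finalSegments-mono (true ∷ g)  (x ∷ as) (y ∷ bs) a≤b (suc i) =
  finalSegments-mono g _ _ (λ { zero → ⊓-monoˡ-≤ (head (blockSizes g)) (a≤b zero) ; (suc j) → a≤b (suc j) }) i

blockCounts-empty : ∀ {n} (g : Vec Bool n) → blockCounts g (replicate (suc n) false) ≡ replicate (suc (cuts g)) 0
blockCounts-empty []          = refl
blockCounts-empty (false ∷ g) = cong (0 ∷_) (blockCounts-empty g)
blockCounts-empty (true ∷ g)  rewrite blockCounts-empty g = refl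

blockCounts-full : ∀ {n} (g : Vec Bool n) → blockCounts g (replicate (suc n) true) ≡ blockSizes g
blockCounts-full []          = refl
blockCounts-full (false ∷ g) = cong (1 ∷_) (blockCounts-full g)
blockCounts-full (true ∷ g)  rewrite blockCounts-full g = refl

blockCounts-injective : ∀ {n} (g : Vec Bool n) {X Y} → UpClosed g X → UpClosed g Y →
                        blockCounts g X ≡ blockCounts g Y → X ≡ Y
blockCounts-injective g {X} {Y} upX upY eq =
  trans (sym (finalSegments∘blockCounts g X upX))
        (trans (cong (finalSegments g) eq) (finalSegments∘blockCounts g Y upY))

replicate-upClosed : ∀ {n} (g : Vec Bool n) b → UpClosed g (replicate (suc n) b)
replicate-upClosed g b t _ bt = trans (lookup-replicate (suc t) b) (trans (sym (lookup-replicate (inject₁ t) b)) bt)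

sum-addHead : ∀ {m} x (c : Vec ℕ (suc m)) → sum (addHead x c) ≡ x + sum c
sum-addHead x (y ∷ c) = +-assoc x y (sum c)

sum-blockSizes : ∀ {n} (g : Vec Bool n) → sum (blockSizes g) ≡ suc n
sum-blockSizes []          = refl
sum-blockSizes (false ∷ g) = cong suc (sum-blockSizes g)
sum-blockSizes (true ∷ g)  = trans (sum-addHead 1 (blockSizes g)) (cong suc (sum-blockSizes g))

blockSizes-positive : ∀ {n} (g : Vec Bool n) j → 1 ≤ lookup (blockSizes g) j
blockSizes-positive []          zero    = s≤s z≤n
blockSizes-positive (false ∷ g) zero    = s≤s z≤n
blockSizes-positive (false ∷ g) (suc j) = blockSizes-positive g j
blockSizes-positive (true ∷ g)  j       = addHead-positive (blockSizes g) (blockSizes-positive g) j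
  where
  addHead-positive : ∀ {m} (c : Vec ℕ (suc m)) → (∀ j → 1 ≤ lookup c j) → ∀ j → 1 ≤ lookup (addHead 1 c) j
  addHead-positive (_ ∷ _) _   zero    = s≤s z≤n
  addHead-positive (_ ∷ _) pos (suc j) = pos (suc j)

-- Vertices of the simplices F(w, π)

-- Vertex m of a simplex starting at w: the coordinates incremented in the
-- first m steps have grown by one, where coordinate i is incremented at step ρ i.
facetVertex : ∀ {n} → Vec ℕ n → (Fin n → ℕ) → ℕ → Vec ℕ n
facetVertex w ρ m = tabulate (λ i → lookup w i + bit (ρ i <ᵇ m))

-- In F(w, π), step t (counted from 0) adds e at π (opposite t).
stepOf : ∀ {n} → Permutation′ n → Fin n → ℕ
stepOf π i = toℕ (opposite (π ⟨$⟩ˡ i))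

lookup-facetVertex : ∀ {n} (w : Vec ℕ n) ρ m i → lookup (facetVertex w ρ m) i ≡ lookup w i + bit (ρ i <ᵇ m)
lookup-facetVertex w ρ m i = lookup∘tabulate _ i

facetVertex-zero : ∀ {n} (w : Vec ℕ n) ρ → facetVertex w ρ 0 ≡ w
facetVertex-zero w ρ = lookup-ext _ _ (λ i → trans (lookup-facetVertex w ρ 0 i) (+-identityʳ _))

<ᵇ-suc : ∀ {x m} → x ≢ m → (x <ᵇ suc m) ≡ (x <ᵇ m)
<ᵇ-suc {x} {m} x≢m with x <? m
... | yes x<m = trans (<ᵇ-true (m<n⇒m<1+n x<m)) (sym (<ᵇ-true x<m))
... | no x≮m  = trans (<ᵇ-false (≤∧≢⇒< (≮⇒≥ x≮m) (x≢m ∘ sym))) (sym (<ᵇ-false (≮⇒≥ x≮m)))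

facetVertex-suc : ∀ {n} (w : Vec ℕ n) ρ m j → ρ j ≡ m → (∀ i → ρ i ≡ m → i ≡ j) →
                  facetVertex w ρ (suc m) ≡ addE (facetVertex w ρ m) j
facetVertex-suc w ρ m j ρj≡m only = lookup-ext _ _ pointwise
  where
  pointwise : ∀ i → lookup (facetVertex w ρ (suc m)) i ≡ lookup (addE (facetVertex w ρ m) j) i
  pointwise i with i ≟ᶠ j
  ... | yes refl rewrite lookup∘updateAt i {suc} (facetVertex w ρ m)
                       | lookup-facetVertex w ρ (suc m) i | lookup-facetVertex w ρ m i | ρj≡m
                       | <ᵇ-true (n<1+n m) | <ᵇ-false (≤-refl {m}) = +-suc _ 0
  ... | no i≢j rewrite lookup∘updateAt′ i j {suc} i≢j (facetVertex w ρ m)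
                     | lookup-facetVertex w ρ (suc m) i | lookup-facetVertex w ρ m i =
    cong (λ b → lookup w i + bit b) (<ᵇ-suc (i≢j ∘ only i))

stepOf-injective : ∀ {n} (π : Permutation′ n) i j → stepOf π i ≡ stepOf π j → i ≡ j
stepOf-injective π i j eq =
  trans (sym (inverseʳ π))
        (trans (cong (π ⟨$⟩ʳ_) (trans (sym (opposite-involutive _))
                                      (trans (cong opposite (toℕ-injective eq)) (opposite-involutive _))))
               (inverseʳ π))

stepOf<n : ∀ {n} (π : Permutation′ n) i → stepOf π i < n
stepOf<n π i = toℕ<n _

scanl-tabulate : ∀ {A B : Set} (f : B → A → B) {len} (F : Fin len → A) (G : ℕ → B) b →
                 G 0 ≡ b → (∀ (t : Fin len) → G (suc (toℕ t)) ≡ f (G (toℕ t)) (F t)) →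
                 scanl f b (List.tabulate F) ≡ applyUpTo G (suc len)
scanl-tabulate f {zero}    F G b g0 gs = cong (List._∷ List.[]) (sym g0)
scanl-tabulate f {suc len} F G b g0 gs =
  cong₂ List._∷_ (sym g0)
        (scanl-tabulate f (F ∘ suc) (G ∘ suc) (f b (F zero))
                        (trans (gs zero) (cong (λ z → f z (F zero)) g0)) (gs ∘ suc))

simplexVerts≡facetVertices : ∀ {n} (w : Vec ℕ n) (π : Permutation′ n) →
                             simplexVerts w π ≡ applyUpTo (facetVertex w (stepOf π)) (suc n)
simplexVerts≡facetVertices {n} w π =
  trans (cong (scanl addE w) (map-tabulate (λ t → t) (λ t → π ⟨$⟩ʳ opposite t)))
        (scanl-tabulate addE (λ t → π ⟨$⟩ʳ opposite t) (facetVertex w (stepOf π)) w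
                        (facetVertex-zero w (stepOf π)) step)
  where
  step : ∀ t → facetVertex w (stepOf π) (suc (toℕ t)) ≡ addE (facetVertex w (stepOf π) (toℕ t)) (π ⟨$⟩ʳ opposite t)
  step t = facetVertex-suc w (stepOf π) (toℕ t) _ stepAt (λ i eq → stepOf-injective π i _ (trans eq (sym stepAt)))
    where
    stepAt : stepOf π (π ⟨$⟩ʳ opposite t) ≡ toℕ t
    stepAt = cong toℕ (trans (cong opposite (inverseˡ π)) (opposite-involutive t))

module _ {n} (w : Vec ℕ n) (π : Permutation′ n) where

  ∈-simplexVerts⁻ : ∀ {x} → x ∈ simplexVerts w π → ∃ λ m → m ≤ n × x ≡ facetVertex w (stepOf π) m
  ∈-simplexVerts⁻ {x} x∈
    with ∈-applyUpTo⁻ (facetVertex w (stepOf π)) (subst (x ∈_) (simplexVerts≡facetVertices w π) x∈)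
  ... | m , m<1+n , x≡ = m , s≤s⁻¹ m<1+n , x≡

  ∈-simplexVerts⁺ : ∀ {m} → m ≤ n → facetVertex w (stepOf π) m ∈ simplexVerts w π
  ∈-simplexVerts⁺ {m} m≤n = subst (facetVertex w (stepOf π) m ∈_) (sym (simplexVerts≡facetVertices w π))
                                  (∈-applyUpTo⁺ (facetVertex w (stepOf π)) (s≤s m≤n))

  All-simplexVerts⁺ : ∀ {P : Vec ℕ n → Set} → (∀ m → m ≤ n → P (facetVertex w (stepOf π) m)) →
                      All P (simplexVerts w π)
  All-simplexVerts⁺ {P} Pm = subst (All P) (sym (simplexVerts≡facetVertices w π))
    (applyUpTo⁺₁ (facetVertex w (stepOf π)) (suc n) (λ {m} m<1+n → Pm m (s≤s⁻¹ m<1+n)))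

injective⇒surjective : ∀ {n} (f : Fin n → Fin n) → Injective _≡_ _≡_ f → ∀ j → ∃ λ i → f i ≡ j
injective⇒surjective {suc m} f inj j with any? (λ i → f i ≟ᶠ j)
... | yes hit = hit
... | no miss = ⊥-elim (<-irrefl refl (injective⇒≤ {f = f′} inj′))
  where
  f′ : Fin (suc m) → Fin m
  f′ i = punchOut {i = j} {j = f i} (λ eq → miss (i , sym eq))
  inj′ : Injective _≡_ _≡_ f′
  inj′ {x} {y} eq = inj (punchOut-injective (λ e → miss (x , sym e)) (λ e → miss (y , sym e)) eq)

permutationWithSteps : ∀ {n} (ρ : Fin n → ℕ) → (∀ i → ρ i < n) → (∀ i j → ρ i ≡ ρ j → i ≡ j) →
                       Σ (Permutation′ n) λ π → ∀ i → stepOf π i ≡ ρ i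
permutationWithSteps {n} ρ ρ<n ρ-inj =
  π , λ i → trans (cong toℕ (opposite-involutive (ρᶠ i))) (toℕ-fromℕ< (ρ<n i))
  where
  ρᶠ : Fin n → Fin n
  ρᶠ i = fromℕ< (ρ<n i)
  ρᶠ-inj : Injective _≡_ _≡_ ρᶠ
  ρᶠ-inj {x} {y} eq = ρ-inj x y (trans (sym (toℕ-fromℕ< (ρ<n x))) (trans (cong toℕ eq) (toℕ-fromℕ< (ρ<n y))))
  ρᶠ⁻¹ : Fin n → Fin n
  ρᶠ⁻¹ j = proj₁ (injective⇒surjective ρᶠ ρᶠ-inj j)
  ρᶠ∘ρᶠ⁻¹ : ∀ j → ρᶠ (ρᶠ⁻¹ j) ≡ j
  ρᶠ∘ρᶠ⁻¹ j = proj₂ (injective⇒surjective ρᶠ ρᶠ-inj j)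
  π : Permutation′ n
  π = permutation (ρᶠ⁻¹ ∘ opposite) (opposite ∘ ρᶠ)
        (λ y → trans (cong ρᶠ⁻¹ (opposite-involutive (ρᶠ y))) (ρᶠ-inj (ρᶠ∘ρᶠ⁻¹ (ρᶠ y))))
        (λ x → trans (cong opposite (ρᶠ∘ρᶠ⁻¹ (opposite x))) (opposite-involutive x))

Succ⇒≢ : ∀ {n} {i j : Fin n} → Succ i j → i ≢ j
Succ⇒≢ {i = i} s refl = <-irrefl refl (subst (toℕ i <_) (sym s) (n<1+n (toℕ i)))

stepOf-reverses : ∀ {n} (π : Permutation′ n) i j → stepOf π j < stepOf π i → toℕ (π ⟨$⟩ˡ i) < toℕ (π ⟨$⟩ˡ j)
stepOf-reverses {n} π i j lt with toℕ (π ⟨$⟩ˡ i) <? toℕ (π ⟨$⟩ˡ j)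
... | yes p = p
... | no ¬p = ⊥-elim (<⇒≱ lt (subst₂ _≤_ (sym (opposite-prop (π ⟨$⟩ˡ i))) (sym (opposite-prop (π ⟨$⟩ˡ j)))
                                    (∸-monoʳ-≤ n (s≤s (≮⇒≥ ¬p)))))

-- If a coordinate i were incremented strictly before i + 1 while w i = w (i + 1),
-- the vertex right after that step would violate monotonicity.
facetVerticesInW⇒consistent : ∀ {n} q (w : Vec ℕ n) (π : Permutation′ n) →
  (∀ m → m ≤ n → InW q (facetVertex w (stepOf π) m)) → Consistent w π
facetVerticesInW⇒consistent {n} q w π inW i j s wi≡wj with stepOf π j <? stepOf π i
... | yes later = stepOf-reverses π i j later
... | no ¬later = ⊥-elim (<-irrefl refl (begin-strict
    lookup w i                     <⟨ n<1+n _ ⟩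
    suc (lookup w i)               ≡⟨ +-comm 1 _ ⟩
    lookup w i + 1                 ≡⟨ cong (λ b → lookup w i + bit b) (<ᵇ-true (n<1+n (ρ i))) ⟨
    lookup w i + bit (ρ i <ᵇ m)    ≡⟨ lookup-facetVertex w ρ m i ⟨
    lookup x i                     ≤⟨ proj₁ (inW m m≤n) i j s ⟩
    lookup x j                     ≡⟨ lookup-facetVertex w ρ m j ⟩
    lookup w j + bit (ρ j <ᵇ m)    ≡⟨ cong (λ b → lookup w j + bit b) (<ᵇ-false ρi<ρj) ⟩
    lookup w j + 0                 ≡⟨ +-identityʳ _ ⟩
    lookup w j                     ≡⟨ wi≡wj ⟨
    lookup w i                     ∎))
  where
  open ≤-Reasoning
  ρ = stepOf π
  ρi<ρj : ρ i < ρ j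
  ρi<ρj = ≤∧≢⇒< (≮⇒≥ ¬later) (Succ⇒≢ s ∘ stepOf-injective π i j)
  m = suc (ρ i)
  m≤n : m ≤ n
  m≤n = ≤-trans ρi<ρj (<⇒≤ (stepOf<n π j))
  x = facetVertex w ρ m

count : ∀ {m} → (Fin m → Bool) → ℕ
count f = ∣ tabulate f ∣

module _ {m} {f g : Fin m → Bool} where

  ⊆ᵇ⇒⊆ : f ⊆ᵇ g → tabulate f ⊆ˢ tabulate g
  ⊆ᵇ⇒⊆ f⊆g {x} x∈f = lookup⇒[]= x _ (trans (lookup∘tabulate g x)
                         (f⊆g x (trans (sym (lookup∘tabulate f x)) ([]=⇒lookup x∈f))))

  count-mono : f ⊆ᵇ g → count f ≤ count g
  count-mono = p⊆q⇒∣p∣≤∣q∣ ∘ ⊆ᵇ⇒⊆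

  count-strict : f ⊆ᵇ g → ∀ j → f j ≡ false → g j ≡ true → count f < count g
  count-strict f⊆g j fj gj = p⊂q⇒∣p∣<∣q∣ (⊆ᵇ⇒⊆ f⊆g , j , in-g , out-f)
    where
    in-g = lookup⇒[]= j _ (trans (lookup∘tabulate g j) gj)
    out-f = λ j∈f → true≢false (trans (sym ([]=⇒lookup j∈f)) (trans (lookup∘tabulate f j) fj))

count<m : ∀ {m} (f : Fin m → Bool) j → f j ≡ false → count f < m
count<m {m} f j fj = <-≤-trans (count-strict (λ _ _ → refl) j fj refl) (∣p∣≤n (tabulate {n = m} λ _ → true))

sumOver : ∀ {A : Set} → List A → (A → ℕ) → ℕ
sumOver []       f = 0
sumOver (u ∷ σ) f = f u + sumOver σ f

sumOver-mono : ∀ {A : Set} (σ : List A) f g → (∀ u → u ∈ σ → f u ≤ g u) → sumOver σ f ≤ sumOver σ g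
sumOver-mono []      f g f≤g = z≤n
sumOver-mono (u ∷ σ) f g f≤g = +-mono-≤ (f≤g u (here refl)) (sumOver-mono σ f g (λ u′ → f≤g u′ ∘ there))

sumOver-strict : ∀ {A : Set} (σ : List A) f g → (∀ u → u ∈ σ → f u ≤ g u) → ∀ u → u ∈ σ → f u < g u →
                 sumOver σ f < sumOver σ g
sumOver-strict (x ∷ σ) f g f≤g u (here refl) lt = +-mono-<-≤ lt (sumOver-mono σ f g (λ u′ → f≤g u′ ∘ there))
sumOver-strict (x ∷ σ) f g f≤g u (there u∈σ) lt =
  +-mono-≤-< (f≤g x (here refl)) (sumOver-strict σ f g (λ u′ → f≤g u′ ∘ there) u u∈σ lt)

-- Counting steps around the cycle 0, 1, …, n

module Cyclic (n : ℕ) where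

  stepsFrom : ℕ → ℕ → ℕ
  stepsFrom m₀ x with x <? m₀
  ... | yes _ = x + suc n ∸ m₀
  ... | no _  = x ∸ m₀

  stepsFrom-below : ∀ {m₀ x} → m₀ ≤ n → x < m₀ → stepsFrom m₀ x ≡ x + suc (n ∸ m₀)
  stepsFrom-below {m₀} {x} m₀≤n x<m₀ with x <? m₀
  ... | yes _ = trans (+-∸-assoc x (≤-trans m₀≤n (n≤1+n n))) (cong (x +_) (+-∸-assoc 1 m₀≤n))
  ... | no x≮m₀ = ⊥-elim (x≮m₀ x<m₀)

  stepsFrom-above : ∀ {m₀ x} → m₀ ≤ x → stepsFrom m₀ x ≡ x ∸ m₀
  stepsFrom-above {m₀} {x} m₀≤x with x <? m₀
  ... | yes x<m₀ = ⊥-elim (<⇒≱ x<m₀ m₀≤x)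
  ... | no _     = refl

  -- Walking forward around the cycle from vertex m₀ to vertex m of a simplex,
  -- the coordinate crossed at step x goes up when step x is passed, and all
  -- coordinates go down when the wrap-around step n is passed.
  crossing-identity : ∀ m₀ x m → m₀ ≤ n → x ≤ n → m ≤ n →
    bit (x <ᵇ m) + bit (stepsFrom m₀ n <ᵇ stepsFrom m₀ m) ≡ bit (x <ᵇ m₀) + bit (stepsFrom m₀ x <ᵇ stepsFrom m₀ m)
  crossing-identity m₀ x m m₀≤n x≤n m≤n with <⊎≥ x m₀ | <⊎≥ m m₀
  ... | inj₁ x<m₀ | inj₁ m<m₀
    rewrite stepsFrom-above m₀≤n | stepsFrom-below m₀≤n x<m₀ | stepsFrom-below m₀≤n m<m₀
          | <ᵇ-true x<m₀ | <ᵇ-iff {x + suc (n ∸ m₀)} {m + suc (n ∸ m₀)} {x} {m} (+-cancelʳ-< _ x m) (+-monoˡ-< _)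
          | <ᵇ-true {n ∸ m₀} {m + suc (n ∸ m₀)} (m≤n+m _ m) = +-comm _ 1
  ... | inj₁ x<m₀ | inj₂ m₀≤m
    rewrite stepsFrom-above m₀≤n | stepsFrom-below m₀≤n x<m₀ | stepsFrom-above m₀≤m
          | <ᵇ-true x<m₀ | <ᵇ-true {x} {m} (<-≤-trans x<m₀ m₀≤m)
          | <ᵇ-false {n ∸ m₀} {m ∸ m₀} (∸-monoˡ-≤ m₀ m≤n)
          | <ᵇ-false {x + suc (n ∸ m₀)} {m ∸ m₀}
                     (≤-trans (∸-monoˡ-≤ m₀ m≤n) (≤-trans (n≤1+n _) (m≤n+m _ x))) = refl
  ... | inj₂ m₀≤x | inj₁ m<m₀
    rewrite stepsFrom-above m₀≤n | stepsFrom-above m₀≤x | stepsFrom-below m₀≤n m<m₀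
          | <ᵇ-false {x} {m₀} m₀≤x | <ᵇ-false {x} {m} (≤-trans (<⇒≤ m<m₀) m₀≤x)
          | <ᵇ-true {n ∸ m₀} {m + suc (n ∸ m₀)} (m≤n+m _ m)
          | <ᵇ-true {x ∸ m₀} {m + suc (n ∸ m₀)} (≤-trans (s≤s (∸-monoˡ-≤ m₀ x≤n)) (m≤n+m _ m)) = refl
  ... | inj₂ m₀≤x | inj₂ m₀≤m
    rewrite stepsFrom-above m₀≤n | stepsFrom-above m₀≤x | stepsFrom-above m₀≤m
          | <ᵇ-false {x} {m₀} m₀≤x | <ᵇ-false {n ∸ m₀} {m ∸ m₀} (∸-monoˡ-≤ m₀ m≤n)
          | <ᵇ-iff {x ∸ m₀} {m ∸ m₀} {x} {m} (λ lt → ≰⇒> (λ m≤x → <⇒≱ lt (∸-monoˡ-≤ m₀ m≤x)))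
                                             (λ x<m → ∸-monoˡ-< x<m m₀≤x) = +-identityʳ _

  -- Inverse of stepsFrom start on 0, …, n, where step n is r₀ steps from start.
  module Inverse (r₀ : ℕ) (r₀≤n : r₀ ≤ n) where

    start : ℕ
    start = n ∸ r₀

    start≤n : start ≤ n
    start≤n = m∸n≤m n r₀

    r₀+start : r₀ + start ≡ n
    r₀+start = m+[n∸m]≡n r₀≤n

    stepsFrom-n : stepsFrom start n ≡ r₀
    stepsFrom-n = trans (stepsFrom-above start≤n) (m∸[m∸n]≡n r₀≤n)

    stepsTo : ℕ → ℕ
    stepsTo r with r ≤? r₀
    ... | yes _ = r + start
    ... | no _  = r ∸ suc r₀

    stepsTo-≤ : ∀ {r} → r ≤ r₀ → stepsTo r ≡ r + start
    stepsTo-≤ {r} r≤r₀ with r ≤? r₀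
    ... | yes _  = refl
    ... | no r≰r₀ = ⊥-elim (r≰r₀ r≤r₀)

    stepsTo-> : ∀ {r} → r₀ < r → stepsTo r ≡ r ∸ suc r₀
    stepsTo-> {r} r₀<r with r ≤? r₀
    ... | yes r≤r₀ = ⊥-elim (<⇒≱ r₀<r r≤r₀)
    ... | no _     = refl

    start≤stepsTo : ∀ {r} → r ≤ r₀ → start ≤ stepsTo r
    start≤stepsTo {r} r≤r₀ rewrite stepsTo-≤ r≤r₀ = m≤n+m start r

    stepsTo<start : ∀ {r} → r ≤ n → r₀ < r → stepsTo r < start
    stepsTo<start {r} r≤n r₀<r rewrite stepsTo-> r₀<r =
      +-cancelˡ-< (suc r₀) _ _ (subst₂ _<_ (sym (m+[n∸m]≡n r₀<r)) (cong suc (sym r₀+start)) (s≤s r≤n))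

    stepsFrom-stepsTo : ∀ {r} → r ≤ n → stepsFrom start (stepsTo r) ≡ r
    stepsFrom-stepsTo {r} r≤n with <⊎≥ r₀ r
    ... | inj₂ r≤r₀ = trans (stepsFrom-above (start≤stepsTo r≤r₀))
                            (trans (cong (_∸ start) (stepsTo-≤ r≤r₀)) (m+n∸n≡m r start))
    ... | inj₁ r₀<r = trans (stepsFrom-below start≤n (stepsTo<start r≤n r₀<r))
                            (trans (cong₂ _+_ (stepsTo-> r₀<r) (cong suc (m∸[m∸n]≡n r₀≤n))) (m∸n+n≡m r₀<r))

    stepsTo<n : ∀ {r} → r ≤ n → r ≢ r₀ → stepsTo r < n
    stepsTo<n {r} r≤n r≢r₀ with <⊎≥ r₀ r
    ... | inj₂ r≤r₀ rewrite stepsTo-≤ r≤r₀ =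
      subst (r + start <_) r₀+start (+-monoˡ-< start (≤∧≢⇒< r≤r₀ r≢r₀))
    ... | inj₁ r₀<r = <-≤-trans (stepsTo<start r≤n r₀<r) start≤n

    stepsTo≤n : ∀ {r} → r ≤ n → stepsTo r ≤ n
    stepsTo≤n {r} r≤n with r ≟ r₀
    ... | yes refl = ≤-reflexive (trans (stepsTo-≤ ≤-refl) r₀+start)
    ... | no r≢r₀  = <⇒≤ (stepsTo<n r≤n r≢r₀)

-- The cycle of gaps around a point

≡ᵇ-true : ∀ {x y} → (x ≡ᵇ y) ≡ true → x ≡ y
≡ᵇ-true {zero}  {zero}  _ = refl
≡ᵇ-true {suc x} {suc y} p = cong suc (≡ᵇ-true p)

≡ᵇ-refl : ∀ x → (x ≡ᵇ x) ≡ true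
≡ᵇ-refl zero    = refl
≡ᵇ-refl (suc x) = ≡ᵇ-refl x

-- For x ∈ ℕⁿ, position p ∈ Fin (n + 1) stands for the gap between padded x p
-- and paddedNext x p in the sequence 0, x₁, …, xₙ, q; read cyclically, the
-- gap after the last position is the first one.  A vertex u next to v is
-- v + e_S − [0 ∈ S] for a set S of positions (Shift S u), and a face through v
-- is a chain of such sets, each closed under stepping over a zero gap of v.
module Around {n : ℕ} (q : ℕ) (v : Vec ℕ n) where

  Pos : Set
  Pos = Fin (suc n)

  next : Pos → Pos
  next p with toℕ p <? n
  ... | yes p<n = fromℕ< (s≤s p<n)
  ... | no _    = zero

  padded : Vec ℕ n → Pos → ℕ
  padded x zero    = 0
  padded x (suc i) = lookup x i

  paddedNext : Vec ℕ n → Pos → ℕ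
  paddedNext x p with toℕ p <? n
  ... | yes p<n = padded x (fromℕ< (s≤s p<n))
  ... | no _    = q

  glued : Pos → Bool
  glued p = padded v p ≡ᵇ paddedNext v p

  Closed : (Pos → Bool) → Set
  Closed S = ∀ p → glued p ≡ true → S p ≡ true → S (next p) ≡ true

  Ascending : Vec ℕ n → Set
  Ascending x = ∀ p → padded x p ≤ paddedNext x p

  Shift : (Pos → Bool) → Vec ℕ n → Set
  Shift S u = ∀ i → lookup u i + bit (S zero) ≡ lookup v i + bit (S (suc i))

  next-inner : ∀ p → toℕ p < n → toℕ (next p) ≡ suc (toℕ p)
  next-inner p p<n with toℕ p <? n
  ... | yes l = toℕ-fromℕ< (s≤s l)
  ... | no ¬l = ⊥-elim (¬l p<n)

  toℕ-next : ∀ p → toℕ (next p) ≡ suc (toℕ p) % suc n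
  toℕ-next p with toℕ p <? n
  ... | yes p<n = trans (toℕ-fromℕ< (s≤s p<n)) (sym (m≤n⇒m%n≡m p<n))
  ... | no p≮n  = sym (trans (cong (λ z → suc z % suc n) p≡n) (n%n≡0 (suc n)))
    where
    p≡n : toℕ p ≡ n
    p≡n = ≤-antisym (s≤s⁻¹ (toℕ<n p)) (≮⇒≥ p≮n)

  paddedNext-inner : ∀ x p → toℕ p < n → paddedNext x p ≡ padded x (next p)
  paddedNext-inner x p p<n with toℕ p <? n
  ... | yes _ = refl
  ... | no ¬l = ⊥-elim (¬l p<n)

  paddedNext-last : ∀ x p → ¬ (toℕ p < n) → paddedNext x p ≡ q
  paddedNext-last x p p≮n with toℕ p <? n
  ... | yes l = ⊥-elim (p≮n l)
  ... | no _  = refl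

  glued-intro : ∀ p → padded v p ≡ paddedNext v p → glued p ≡ true
  glued-intro p eq = subst (λ z → (padded v p ≡ᵇ z) ≡ true) eq (≡ᵇ-refl (padded v p))

  InW⇒Ascending : ∀ x → InW q x → Ascending x
  InW⇒Ascending x (mono , bd) zero = z≤n
  InW⇒Ascending x (mono , bd) (suc i) with toℕ (suc i) <? n
  ... | yes lt = mono i (fromℕ< lt) (toℕ-fromℕ< lt)
  ... | no _   = bd i

  ascending-≤q : ∀ x → Ascending x → ∀ d (i : Fin n) → toℕ i + d ≡ n → lookup x i ≤ q
  ascending-≤q x asc d i i+d≡n with asc (suc i)
  ... | step with toℕ (suc i) <? n
  ... | no _ = step
  ascending-≤q x asc zero    i i+d≡n | _ | yes lt =
    ⊥-elim (<-irrefl refl (<-trans (n<1+n (toℕ i)) (subst (suc (toℕ i) <_) (trans (sym i+d≡n) (+-identityʳ _)) lt)))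
  ascending-≤q x asc (suc d) i i+d≡n | step | yes lt =
    ≤-trans step (ascending-≤q x asc d (fromℕ< lt) (trans (cong (_+ d) (toℕ-fromℕ< lt)) (trans (sym (+-suc _ d)) i+d≡n)))

  Ascending⇒InW : ∀ x → Ascending x → InW q x
  Ascending⇒InW x asc = mono , λ i → ascending-≤q x asc (n ∸ toℕ i) i (m+[n∸m]≡n (<⇒≤ (toℕ<n i)))
    where
    mono : ∀ i j → Succ i j → lookup x i ≤ lookup x j
    mono i j s with asc (suc i)
    ... | step with toℕ (suc i) <? n
    ... | yes lt = subst (λ z → lookup x i ≤ lookup x z) (toℕ-injective (trans (toℕ-fromℕ< lt) (sym s))) step
    ... | no ¬lt = ⊥-elim (¬lt (subst (_< n) s (toℕ<n j)))

  next-induction : (P : Pos → Set) → P zero → (∀ p → toℕ p < n → P p → P (next p)) → ∀ p → P p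
  next-induction P P0 step p = subst P (fromℕ<-toℕ p (toℕ<n p)) (go (toℕ p) (toℕ<n p))
    where
    go : ∀ t (t<1+n : t < suc n) → P (fromℕ< t<1+n)
    go zero    _       = P0
    go (suc t) t+1<1+n = subst P next≡ (step p′ p′<n (go t t<1+n))
      where
      t<1+n = <-trans (n<1+n t) t+1<1+n
      p′ = fromℕ< t<1+n
      p′<n : toℕ p′ < n
      p′<n = subst (_< n) (sym (toℕ-fromℕ< t<1+n)) (s≤s⁻¹ t+1<1+n)
      next≡ : next p′ ≡ fromℕ< t+1<1+n
      next≡ = toℕ-injective (trans (next-inner p′ p′<n) (trans (cong suc (toℕ-fromℕ< t<1+n)) (sym (toℕ-fromℕ< t+1<1+n))))

  Shift-padded : ∀ S u → Shift S u → ∀ p → padded u p + bit (S zero) ≡ padded v p + bit (S p)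
  Shift-padded S u sh zero    = refl
  Shift-padded S u sh (suc i) = sh i

  Shift-paddedNext : ∀ S u → Shift S u → ∀ p → paddedNext u p + bit (S zero) ≡ paddedNext v p + bit (S (next p))
  Shift-paddedNext S u sh p with toℕ p <? n
  ... | yes _ = Shift-padded S u sh _
  ... | no _  = refl

  Shift-unique : ∀ S x y → Shift S x → Shift S y → x ≡ y
  Shift-unique S x y shx shy = lookup-ext x y (λ i → +-cancelʳ-≡ _ _ _ (trans (shx i) (sym (shy i))))

  Shift-cong : ∀ S S′ u → (∀ p → S p ≡ S′ p) → Shift S u → Shift S′ u
  Shift-cong S S′ u S≗S′ sh i =
    subst₂ (λ a b → lookup u i + bit a ≡ lookup v i + bit b) (S≗S′ zero) (S≗S′ (suc i)) (sh i)

  -- Over a zero gap of v, leaving S would make u decrease there.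
  Shift-closed : ∀ S u → Ascending u → Shift S u → Closed S
  Shift-closed S u asc sh p glue Sp with S (next p) in Snext
  ... | true  = refl
  ... | false = ⊥-elim (<-irrefl refl (begin-strict
      padded v p + 1                   ≡⟨ cong (λ b → padded v p + bit b) Sp ⟨
      padded v p + bit (S p)           ≡⟨ Shift-padded S u sh p ⟨
      padded u p + bit (S zero)        ≤⟨ +-monoˡ-≤ _ (asc p) ⟩
      paddedNext u p + bit (S zero)    ≡⟨ Shift-paddedNext S u sh p ⟩
      paddedNext v p + bit (S (next p)) ≡⟨ cong₂ (λ z b → z + bit b) (sym (≡ᵇ-true glue)) Snext ⟩
      padded v p + 0                   <⟨ +-monoʳ-< (padded v p) (s≤s z≤n) ⟩
      padded v p + 1                   ∎))
    where open ≤-Reasoning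

  -- If 0 ∈ S, every coordinate of v outside S is positive: going along the
  -- cycle from 0, a zero coordinate is reached only over zero gaps.
  closed-noUnderflow : Ascending v → ∀ S → Closed S → ∀ p → bit (S zero) ≤ padded v p + bit (S p)
  closed-noUnderflow asc S closed = next-induction _ ≤-refl step
    where
    step : ∀ p → toℕ p < n → bit (S zero) ≤ padded v p + bit (S p) → bit (S zero) ≤ padded v (next p) + bit (S (next p))
    step p p<n ih with padded v (next p) in eq
    ... | suc _ = ≤-trans (bit≤1 _) (s≤s z≤n)
    ... | zero  = begin
        bit (S zero)           ≤⟨ ih ⟩
        padded v p + bit (S p) ≡⟨ cong (_+ bit (S p)) p0 ⟩
        bit (S p)              ≤⟨ bit-mono (closed p (glued-intro p (trans p0 (sym next0)))) ⟩
        bit (S (next p))       ∎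
      where
      open ≤-Reasoning
      next0 : paddedNext v p ≡ 0
      next0 = trans (paddedNext-inner v p p<n) eq
      p0 : padded v p ≡ 0
      p0 = n≤0⇒n≡0 (subst (padded v p ≤_) next0 (asc p))

  shiftBy : (Pos → Bool) → Vec ℕ n
  shiftBy S = tabulate (λ i → lookup v i + bit (S (suc i)) ∸ bit (S zero))

  shiftBy-Shift : Ascending v → ∀ S → Closed S → Shift S (shiftBy S)
  shiftBy-Shift asc S closed i =
    trans (cong (_+ bit (S zero)) (lookup∘tabulate _ i)) (m∸n+n≡m (closed-noUnderflow asc S closed (suc i)))

  shiftBy-ascending : Ascending v → ∀ S → Closed S → Ascending (shiftBy S)
  shiftBy-ascending asc S closed p = +-cancelʳ-≤ (bit (S zero)) _ _
    (subst₂ _≤_ (sym (Shift-padded S u sh p)) (sym (Shift-paddedNext S u sh p)) gap)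
    where
    u = shiftBy S
    sh = shiftBy-Shift asc S closed
    gap : padded v p + bit (S p) ≤ paddedNext v p + bit (S (next p))
    gap with padded v p <? paddedNext v p
    ... | yes lt = ≤-trans (+-monoʳ-≤ _ (bit≤1 (S p))) (≤-trans (subst (_≤ paddedNext v p) (+-comm 1 _) lt) (m≤m+n _ _))
    ... | no ¬lt with ≤-antisym (asc p) (≮⇒≥ ¬lt) | S p in Sp
    ... | _  | false = +-mono-≤ (asc p) z≤n
    ... | eq | true  rewrite closed p (glued-intro p eq) Sp = +-monoˡ-≤ 1 (asc p)

  shiftBy-cong : ∀ S S′ → (∀ p → S p ≡ S′ p) → shiftBy S ≡ shiftBy S′
  shiftBy-cong S S′ S≗S′ =
    tabulate-cong (λ i → cong₂ (λ a b → lookup v i + bit a ∸ bit b) (S≗S′ (suc i)) (S≗S′ zero))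

  shiftSet : Vec ℕ n → Pos → Bool
  shiftSet u zero    = does (any? λ i → lookup u i <? lookup v i)
  shiftSet u (suc i) = lookup v i <ᵇ lookup u i + bit (shiftSet u zero)

  shiftSet-zero : ∀ S u → Shift S u → (∃ λ p → S p ≡ false) → shiftSet u zero ≡ S zero
  shiftSet-zero S u sh (p , Sp) with S zero in S0
  ... | true  = dec-true (any? _) (decreases p Sp)
    where
    decreases : ∀ p → S p ≡ false → ∃ λ i → lookup u i < lookup v i
    decreases zero    S0≡false = ⊥-elim (true≢false (trans (sym S0) S0≡false))
    decreases (suc i) Si≡false = i , subst (_≤ lookup v i) (+-comm (lookup u i) 1)
      (≤-reflexive (trans (sh i) (trans (cong (λ b → lookup v i + bit b) Si≡false) (+-identityʳ _))))
  ... | false = dec-false (any? _) λ (i , u<v) →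
    <⇒≱ u<v (≤-trans (m≤m+n (lookup v i) (bit (S (suc i)))) (≤-reflexive (trans (sym (sh i)) (+-identityʳ _))))

  shiftSet-correct : ∀ S u → Shift S u → (∃ λ p → S p ≡ false) → ∀ p → shiftSet u p ≡ S p
  shiftSet-correct S u sh out zero = shiftSet-zero S u sh out
  shiftSet-correct S u sh out (suc i) rewrite shiftSet-zero S u sh out | sh i with S (suc i)
  ... | true  = <ᵇ-true (subst (lookup v i <_) (+-comm 1 _) ≤-refl)
  ... | false = <ᵇ-false (≤-reflexive (+-identityʳ (lookup v i)))

  Shift-nonconstant : ∀ S u → Shift S u → u ≢ v → (∃ λ p → S p ≡ false) × (∃ λ p → S p ≡ true)
  Shift-nonconstant S u sh u≢v with all? (λ p → S p ≟ᵇ S zero)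
  ... | yes constant = ⊥-elim (u≢v (lookup-ext u v (λ i →
          +-cancelʳ-≡ _ _ _ (trans (sh i) (cong (λ b → lookup v i + bit b) (constant (suc i)))))))
  ... | no ¬constant with ¬∀⟶∃¬ (suc n) (λ p → S p ≡ S zero) (λ p → S p ≟ᵇ S zero) ¬constant
  ... | p , Sp≢S0 with S zero in S0 | S p in Sp
  ... | true  | true  = ⊥-elim (Sp≢S0 refl)
  ... | true  | false = (p , Sp) , (zero , S0)
  ... | false | true  = (zero , S0) , (p , Sp)
  ... | false | false = ⊥-elim (Sp≢S0 refl)

  Shift-self⇒constant : ∀ S → Shift S v → ∀ i → S (suc i) ≡ S zero
  Shift-self⇒constant S sh i = bit-injective (sym (+-cancelˡ-≡ (lookup v i) _ _ (sh i)))

  open Cyclic n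

  prefix : (Pos → ℕ) → ℕ → Pos → Bool
  prefix R r p = R p <ᵇ r

  -- The step of a simplex at which gap p is crossed; gap 0 is crossed by the
  -- last step n, after which every coordinate has gone up.
  crossing : (Fin n → ℕ) → Pos → ℕ
  crossing ρ zero    = n
  crossing ρ (suc i) = ρ i

  facetVertex-Shift : ∀ w ρ → (∀ i → ρ i ≤ n) → ∀ {m₀} → m₀ ≤ n → v ≡ facetVertex w ρ m₀ →
                      ∀ {m} → m ≤ n →
                      Shift (prefix (stepsFrom m₀ ∘ crossing ρ) (stepsFrom m₀ m)) (facetVertex w ρ m)
  facetVertex-Shift w ρ ρ≤n {m₀} m₀≤n v≡ {m} m≤n i = begin
      lookup (facetVertex w ρ m) i + late n               ≡⟨ cong (_+ late n) (lookup-facetVertex w ρ m i) ⟩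
      lookup w i + bit (ρ i <ᵇ m) + late n                ≡⟨ +-assoc (lookup w i) _ _ ⟩
      lookup w i + (bit (ρ i <ᵇ m) + late n)              ≡⟨ cong (lookup w i +_) identity ⟩
      lookup w i + (bit (ρ i <ᵇ m₀) + late (ρ i))         ≡⟨ +-assoc (lookup w i) _ _ ⟨
      lookup w i + bit (ρ i <ᵇ m₀) + late (ρ i)           ≡⟨ cong (_+ late (ρ i)) (lookup-facetVertex w ρ m₀ i) ⟨
      lookup (facetVertex w ρ m₀) i + late (ρ i)          ≡⟨ cong (λ x → lookup x i + late (ρ i)) v≡ ⟨
      lookup v i + late (ρ i)                             ∎
    where
    open ≡-Reasoning
    late : ℕ → ℕ
    late x = bit (stepsFrom m₀ x <ᵇ stepsFrom m₀ m)
    identity = crossing-identity m₀ (ρ i) m m₀≤n (ρ≤n i) m≤n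

  face⇒ranking : ∀ (σ : List (Vec ℕ n)) → Face (T (suc n) q) (v ∷ σ) →
                 Σ (Pos → ℕ) λ R → ∀ u → u ∈ σ → Σ ℕ λ r → Shift (prefix R r) u × InW q u
  face⇒ranking σ (w , π , _ , _ , allInW , sub) with ∈-simplexVerts⁻ w π (sub (here refl))
  ... | m₀ , m₀≤n , v≡ = stepsFrom m₀ ∘ crossing ρ , λ u u∈σ → ranked u (sub (there u∈σ))
    where
    ρ = stepOf π
    ranked : ∀ u → u ∈ simplexVerts w π → Σ ℕ λ r → Shift (prefix (stepsFrom m₀ ∘ crossing ρ) r) u × InW q u
    ranked u u∈ with ∈-simplexVerts⁻ w π u∈
    ... | m , m≤n , refl =
      stepsFrom m₀ m , facetVertex-Shift w ρ (λ i → <⇒≤ (stepOf<n π i)) m₀≤n v≡ m≤n , All.lookup allInW u∈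

  -- The simplex realising a ranking R starts at the vertex w below v and
  -- crosses gap p after R p steps from v; gap 0 fixes where v sits on it.
  module FaceFromRanking (vInW : InW q v) (R : Pos → ℕ) (R≤n : ∀ p → R p ≤ n)
                         (R-injective : ∀ p p′ → R p ≡ R p′ → p ≡ p′) (closed : ∀ r → Closed (prefix R r)) where

    open Inverse (R zero) (R≤n zero)

    asc : Ascending v
    asc = InW⇒Ascending v vInW

    ρ : Fin n → ℕ
    ρ i = stepsTo (R (suc i))

    ρ<n : ∀ i → ρ i < n
    ρ<n i = stepsTo<n (R≤n _) (λ eq → suc≢zero (R-injective _ _ eq))
      where
      suc≢zero : suc i ≢ zero
      suc≢zero ()

    ρ-injective : ∀ i j → ρ i ≡ ρ j → i ≡ j
    ρ-injective i j eq = Fin-suc-injective (R-injective (suc i) (suc j)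
      (trans (sym (stepsFrom-stepsTo (R≤n _))) (trans (cong (stepsFrom start) eq) (stepsFrom-stepsTo (R≤n _)))))

    π : Permutation′ n
    π = proj₁ (permutationWithSteps ρ ρ<n ρ-injective)

    w : Vec ℕ n
    w = tabulate (λ i → lookup v i ∸ bit (ρ i <ᵇ start))

    crossedEarly-positive : ∀ i → bit (ρ i <ᵇ start) ≤ lookup v i
    crossedEarly-positive i with <⊎≥ (R zero) (R (suc i))
    ... | inj₂ late rewrite <ᵇ-false {ρ i} {start} (start≤stepsTo late) = z≤n
    ... | inj₁ early = ≤-trans (bit≤1 _) (subst (1 ≤_) (+-identityʳ _)
        (subst₂ (λ a b → bit a ≤ lookup v i + bit b) (<ᵇ-true (n<1+n (R zero))) (<ᵇ-false early)
                (closed-noUnderflow asc _ (closed (suc (R zero))) (suc i))))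

    v≡start : v ≡ facetVertex w ρ start
    v≡start = lookup-ext _ _ λ i → sym (trans (lookup-facetVertex w ρ start i)
      (trans (cong (_+ bit (ρ i <ᵇ start)) (lookup∘tabulate _ i)) (m∸n+n≡m (crossedEarly-positive i))))

    stepsFrom-crossing : ∀ p → stepsFrom start (crossing ρ p) ≡ R p
    stepsFrom-crossing zero    = stepsFrom-n
    stepsFrom-crossing (suc i) = stepsFrom-stepsTo (R≤n _)

    vertex-Shift : ∀ {m} → m ≤ n → Shift (prefix R (stepsFrom start m)) (facetVertex w ρ m)
    vertex-Shift {m} m≤n = Shift-cong _ (prefix R (stepsFrom start m)) (facetVertex w ρ m)
                                  (λ p → cong (_<ᵇ stepsFrom start m) (stepsFrom-crossing p))
                                  (facetVertex-Shift w ρ (<⇒≤ ∘ ρ<n) start≤n v≡start m≤n)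

    vertex-InW : ∀ {m} → m ≤ n → InW q (facetVertex w ρ m)
    vertex-InW {m} m≤n =
      subst (InW q) (Shift-unique S (shiftBy S) (facetVertex w ρ m) (shiftBy-Shift asc S closedS) (vertex-Shift m≤n))
            (Ascending⇒InW _ (shiftBy-ascending asc S closedS))
      where
      S = prefix R (stepsFrom start m)
      closedS = closed (stepsFrom start m)

    stepOf≗ρ : ∀ m → facetVertex w (stepOf π) m ≡ facetVertex w ρ m
    stepOf≗ρ m = tabulate-cong λ i →
      cong (λ z → lookup w i + bit (z <ᵇ m)) (proj₂ (permutationWithSteps ρ ρ<n ρ-injective) i)

    vertex∈ : ∀ {m} → m ≤ n → facetVertex w ρ m ∈ simplexVerts w π
    vertex∈ {m} m≤n = subst (_∈ simplexVerts w π) (stepOf≗ρ m) (∈-simplexVerts⁺ w π m≤n)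

    vertices-InW : ∀ m → m ≤ n → InW q (facetVertex w (stepOf π) m)
    vertices-InW m m≤n = subst (InW q) (sym (stepOf≗ρ m)) (vertex-InW m≤n)

    ranking⇒face : ∀ (σ : List (Vec ℕ n)) → (∀ u → u ∈ σ → Σ ℕ λ r → r ≤ n × Shift (prefix R r) u) →
                   Face (T (suc n) q) (v ∷ σ)
    ranking⇒face σ ranked =
      w , π , subst (InW q) (facetVertex-zero w ρ) (vertex-InW z≤n) ,
      facetVerticesInW⇒consistent q w π vertices-InW , All-simplexVerts⁺ w π vertices-InW , sub
      where
      sub : (v ∷ σ) ⊆ simplexVerts w π
      sub (here refl) = subst (_∈ simplexVerts w π) (sym v≡start) (vertex∈ start≤n)
      sub {u} (there u∈σ) with ranked u u∈σ
      ... | r , r≤n , sh = subst (_∈ simplexVerts w π) (sym u≡) (vertex∈ (stepsTo≤n r≤n))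
        where
        u≡ : u ≡ facetVertex w ρ (stepsTo r)
        u≡ = Shift-unique (prefix R r) u (facetVertex w ρ (stepsTo r)) sh
               (subst (λ z → Shift (prefix R z) (facetVertex w ρ (stepsTo r))) (stepsFrom-stepsTo r≤n)
                      (vertex-Shift (stepsTo≤n r≤n)))

  -- A position lying in more sets of the chain gets a smaller rank, so each
  -- set of the chain is a prefix of the ranking; ties are broken by tb, which
  -- grows along glued steps, so that every prefix is closed.
  module RankingOfChain (tb : Pos → ℕ) (tb≤n : ∀ p → tb p ≤ n) (tb-injective : ∀ p p′ → tb p ≡ tb p′ → p ≡ p′)
                        (tb-next : ∀ p → glued p ≡ true → tb p < tb (next p))
                        (σ : List (Vec ℕ n)) (set : Vec ℕ n → Pos → Bool)
                        (closed : ∀ u → u ∈ σ → Closed (set u))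
                        (notFull : ∀ u → u ∈ σ → ∃ λ p → set u p ≡ false)
                        (chain : ∀ u u′ → u ∈ σ → u′ ∈ σ → set u ⊆ᵇ set u′ ⊎ set u′ ⊆ᵇ set u) where

    depth : Pos → ℕ
    depth p = sumOver σ (λ u → bit (set u p))

    key : Pos → ℕ
    key p = depth p * suc n + tb p

    key-depth : ∀ p p′ → depth p < depth p′ → key p < key p′
    key-depth p p′ lt = begin-strict
        depth p * suc n + tb p  <⟨ +-monoʳ-< (depth p * suc n) (s≤s (tb≤n p)) ⟩
        depth p * suc n + suc n ≡⟨ +-comm (depth p * suc n) (suc n) ⟩
        suc (depth p) * suc n   ≤⟨ *-monoˡ-≤ (suc n) lt ⟩
        depth p′ * suc n        ≤⟨ m≤m+n _ _ ⟩
        key p′                  ∎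
      where open ≤-Reasoning

    key-tb : ∀ p p′ → depth p ≡ depth p′ → tb p < tb p′ → key p < key p′
    key-tb p p′ eq lt rewrite eq = +-monoʳ-< (depth p′ * suc n) lt

    key⇒depth : ∀ p p′ → key p < key p′ → depth p ≤ depth p′
    key⇒depth p p′ lt with depth p′ <? depth p
    ... | yes l = ⊥-elim (<-asym lt (key-depth p′ p l))
    ... | no l  = ≮⇒≥ l

    key-injective : ∀ p p′ → key p ≡ key p′ → p ≡ p′
    key-injective p p′ eq with <-cmp (depth p) (depth p′)
    ... | tri< l _ _ = ⊥-elim (<-irrefl eq (key-depth p p′ l))
    ... | tri> _ _ l = ⊥-elim (<-irrefl (sym eq) (key-depth p′ p l))
    ... | tri≈ _ d _ with <-cmp (tb p) (tb p′)
    ...   | tri< l _ _ = ⊥-elim (<-irrefl eq (key-tb p p′ d l))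
    ...   | tri> _ _ l = ⊥-elim (<-irrefl (sym eq) (key-tb p′ p (sym d) l))
    ...   | tri≈ _ t _ = tb-injective p p′ t

    key-irrefl : ∀ p → (key p <ᵇ key p) ≡ false
    key-irrefl p = <ᵇ-false {key p} {key p} ≤-refl

    rank : Pos → ℕ
    rank p = count (λ x → key p <ᵇ key x)

    rank≤n : ∀ p → rank p ≤ n
    rank≤n p = s≤s⁻¹ (count<m (λ x → key p <ᵇ key x) p (key-irrefl p))

    rank-antitone : ∀ p p′ → key p < key p′ → rank p′ < rank p
    rank-antitone p p′ lt = count-strict (λ x h → <ᵇ-true (<-trans lt (<ᵇ-true⁻¹ (key p′) (key x) h)))
                                         p′ (key-irrefl p′) (<ᵇ-true lt)

    rank-injective : ∀ p p′ → rank p ≡ rank p′ → p ≡ p′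
    rank-injective p p′ eq with <-cmp (key p) (key p′)
    ... | tri< l _ _ = ⊥-elim (<-irrefl (sym eq) (rank-antitone p p′ l))
    ... | tri> _ _ l = ⊥-elim (<-irrefl eq (rank-antitone p′ p l))
    ... | tri≈ _ k _ = key-injective p p′ k

    prefix-closed : ∀ r → Closed (prefix rank r)
    prefix-closed r p glue inPrefix = <ᵇ-true (<-trans (rank-antitone p (next p) key<) (<ᵇ-true⁻¹ (rank p) r inPrefix))
      where
      depth≤ : depth p ≤ depth (next p)
      depth≤ = sumOver-mono σ _ _ (λ u u∈σ → bit-mono (closed u u∈σ p glue))
      key< : key p < key (next p)
      key< with depth p <? depth (next p)
      ... | yes l = key-depth p (next p) l
      ... | no l  = key-tb p (next p) (≤-antisym depth≤ (≮⇒≥ l)) (tb-next p glue)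

    set-upward : ∀ u → u ∈ σ → ∀ p x → key p < key x → set u p ≡ true → set u x ≡ true
    set-upward u u∈σ p x lt p∈u with set u x in x∈u
    ... | true  = refl
    ... | false = ⊥-elim (<⇒≱ (sumOver-strict σ (λ u → bit (set u x)) (λ u → bit (set u p)) fewer u u∈σ strict)
                               (key⇒depth p x lt))
      where
      fewer : ∀ u′ → u′ ∈ σ → bit (set u′ x) ≤ bit (set u′ p)
      fewer u′ u′∈σ with chain u u′ u∈σ u′∈σ
      ... | inj₁ u⊆u′ = bit-mono (λ _ → u⊆u′ p p∈u)
      ... | inj₂ u′⊆u = bit-mono (λ x∈u′ → ⊥-elim (true≢false (trans (sym (u′⊆u x x∈u′)) x∈u)))
      strict : bit (set u x) < bit (set u p)
      strict rewrite x∈u | p∈u = s≤s z≤n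

    size : Vec ℕ n → ℕ
    size u = count (set u)

    size≤n : ∀ u → u ∈ σ → size u ≤ n
    size≤n u u∈σ = s≤s⁻¹ (count<m (set u) (proj₁ (notFull u u∈σ)) (proj₂ (notFull u u∈σ)))

    set-prefix : ∀ u → u ∈ σ → ∀ p → set u p ≡ prefix rank (size u) p
    set-prefix u u∈σ p with set u p in p∈u
    ... | true  = sym (<ᵇ-true (count-strict (λ x h → set-upward u u∈σ p x (<ᵇ-true⁻¹ (key p) (key x) h) p∈u)
                                             p (key-irrefl p) p∈u))
    ... | false = sym (<ᵇ-false (count-mono later))
      where
      later : set u ⊆ᵇ (λ x → key p <ᵇ key x)
      later x x∈u with <-cmp (key p) (key x)
      ... | tri< l _ _ = <ᵇ-true l
      ... | tri≈ _ k _ rewrite key-injective p x k = ⊥-elim (true≢false (trans (sym x∈u) p∈u))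
      ... | tri> _ _ l = ⊥-elim (true≢false (trans (sym (set-upward u u∈σ x p l x∈u)) p∈u))

  record LinkVertex (u : Vec ℕ n) : Set where
    field
      shift    : Shift (shiftSet u) u
      closed   : Closed (shiftSet u)
      notFull  : ∃ λ p → shiftSet u p ≡ false
      notEmpty : ∃ λ p → shiftSet u p ≡ true

  linkVertex : ∀ S u → Shift S u → InW q u → u ≢ v → LinkVertex u × (∀ p → shiftSet u p ≡ S p)
  linkVertex S u sh uInW u≢v = record
    { shift    = shiftSet-Shift
    ; closed   = Shift-closed (shiftSet u) u (InW⇒Ascending u uInW) shiftSet-Shift
    ; notFull  = proj₁ out , trans (shiftSet≗S (proj₁ out)) (proj₂ out)
    ; notEmpty = proj₁ in′ , trans (shiftSet≗S (proj₁ in′)) (proj₂ in′)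
    } , shiftSet≗S
    where
    out = proj₁ (Shift-nonconstant S u sh u≢v)
    in′ = proj₂ (Shift-nonconstant S u sh u≢v)
    shiftSet≗S = shiftSet-correct S u sh out
    shiftSet-Shift = Shift-cong S (shiftSet u) u (sym ∘ shiftSet≗S) sh

  prefix-mono : ∀ R {r r′} → r ≤ r′ → prefix R r ⊆ᵇ prefix R r′
  prefix-mono R r≤r′ p = <ᵇ-mono (R p) r≤r′

  linkFace⇒chain : ∀ {σ} → Face (link (T (suc n) q) v) σ → ∀ {u u′} → u ∈ σ → u′ ∈ σ →
                   shiftSet u ⊆ᵇ shiftSet u′ ⊎ shiftSet u′ ⊆ᵇ shiftSet u
  linkFace⇒chain {σ} (v∉σ , face) u∈σ u′∈σ =
    Sum.map (included u∈σ u′∈σ) (included u′∈σ u∈σ) (≤-total (r u∈σ) (r u′∈σ))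
    where
    R = proj₁ (face⇒ranking σ face)
    ranked = proj₂ (face⇒ranking σ face)
    r : ∀ {x} → x ∈ σ → ℕ
    r x∈σ = proj₁ (ranked _ x∈σ)
    asPrefix : ∀ {x} (x∈σ : x ∈ σ) p → shiftSet x p ≡ prefix R (r x∈σ) p
    asPrefix {x} x∈σ = proj₂ (linkVertex (prefix R (r x∈σ)) x (proj₁ (proj₂ (ranked x x∈σ)))
                                         (proj₂ (proj₂ (ranked x x∈σ))) (λ x≡v → v∉σ (subst (_∈ σ) x≡v x∈σ)))
    included : ∀ {x y} (x∈σ : x ∈ σ) (y∈σ : y ∈ σ) → r x∈σ ≤ r y∈σ → shiftSet x ⊆ᵇ shiftSet y
    included x∈σ y∈σ r≤r′ p h = trans (asPrefix y∈σ p) (prefix-mono R r≤r′ p (trans (sym (asPrefix x∈σ p)) h))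

  vertex⇒LinkVertex : ∀ {u} → Vertex (link (T (suc n) q) v) u → LinkVertex u
  vertex⇒LinkVertex {u} (v∉[u] , face) with face⇒ranking (u ∷ []) face
  ... | R , ranked with ranked u (here refl)
  ...   | r , sh , uInW = proj₁ (linkVertex (prefix R r) u sh uInW (λ u≡v → v∉[u] (here (sym u≡v))))

  -- The cycle of gaps read as the row 0, …, n of a glue pattern, starting
  -- right after an unglued gap: row position t is the gap at t.
  record Cut : Set where
    field
      gluePattern  : Vec Bool n
      at index     : Fin (suc n) → Pos
      index-at     : ∀ t → index (at t) ≡ t
      at-index     : ∀ p → at (index p) ≡ p
      glued-at     : ∀ (t : Fin n) → glued (at (inject₁ t)) ≡ lookup gluePattern t
      next-at      : ∀ (t : Fin n) → next (at (inject₁ t)) ≡ at (suc t)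
      last-unglued : glued (at (fromℕ n)) ≡ false

  module LinkIso (vInW : InW q v) (cut : Cut) where

    open Cut cut
    open LinkVertex

    linear : (Pos → Bool) → Vec Bool (suc n)
    linear S = tabulate (S ∘ at)

    cyclic : Vec Bool (suc n) → Pos → Bool
    cyclic X p = lookup X (index p)

    lookup-linear : ∀ S t → lookup (linear S) t ≡ S (at t)
    lookup-linear S = lookup∘tabulate (S ∘ at)

    linear-cyclic : ∀ X → linear (cyclic X) ≡ X
    linear-cyclic X = trans (tabulate-cong (λ t → cong (lookup X) (index-at t))) (tabulate∘lookup X)

    cyclic-linear : ∀ S p → cyclic (linear S) p ≡ S p
    cyclic-linear S p = trans (lookup-linear S (index p)) (cong S (at-index p))

    index-glued : ∀ p → glued p ≡ true → ∃ λ t → index p ≡ inject₁ t × index (next p) ≡ suc t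
    index-glued p glue with fromℕ⊎inject₁ (index p)
    ... | inj₁ eq =
      ⊥-elim (true≢false (trans (sym glue) (trans (cong glued (trans (sym (at-index p)) (cong at eq))) last-unglued)))
    ... | inj₂ (t , eq) =
      t , eq , trans (cong (index ∘ next) (sym at-t)) (trans (cong index (next-at t)) (index-at (suc t)))
      where
      at-t : at (inject₁ t) ≡ p
      at-t = trans (cong at (sym eq)) (at-index p)

    closed⇒upClosed : ∀ S → Closed S → UpClosed gluePattern (linear S)
    closed⇒upClosed S closed t glue St =
      trans (lookup-linear S (suc t))
            (subst (λ z → S z ≡ true) (next-at t)
                   (closed (at (inject₁ t)) (trans (glued-at t) glue) (trans (sym (lookup-linear S (inject₁ t))) St)))

    upClosed⇒closed : ∀ X → UpClosed gluePattern X → Closed (cyclic X)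
    upClosed⇒closed X up p glue Xp with index-glued p glue
    ... | t , p≡ , next≡ rewrite p≡ | next≡ =
      up t (trans (sym (glued-at t)) (trans (cong glued (trans (cong at (sym p≡)) (at-index p))) glue)) Xp

    tieBreak : Pos → ℕ
    tieBreak = toℕ ∘ index

    tieBreak-injective : ∀ p p′ → tieBreak p ≡ tieBreak p′ → p ≡ p′
    tieBreak-injective p p′ eq = trans (sym (at-index p)) (trans (cong at (toℕ-injective eq)) (at-index p′))

    tieBreak-next : ∀ p → glued p ≡ true → tieBreak p < tieBreak (next p)
    tieBreak-next p glue with index-glued p glue
    ... | t , p≡ , next≡ = subst₂ _<_ (sym (trans (cong toℕ p≡) (toℕ-inject₁ t))) (sym (cong toℕ next≡)) ≤-refl

    chain⇒face : ∀ σ → (∀ u → u ∈ σ → LinkVertex u) →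
                 (∀ u u′ → u ∈ σ → u′ ∈ σ → shiftSet u ⊆ᵇ shiftSet u′ ⊎ shiftSet u′ ⊆ᵇ shiftSet u) →
                 Face (T (suc n) q) (v ∷ σ)
    chain⇒face σ lv chain =
      ranking⇒face σ (λ u u∈σ → size u , size≤n u u∈σ , Shift-cong _ _ u (set-prefix u u∈σ) (shift (lv u u∈σ)))
      where
      open RankingOfChain tieBreak (λ p → s≤s⁻¹ (toℕ<n (index p))) tieBreak-injective tieBreak-next
                          σ shiftSet (λ u → closed ∘ lv u) (λ u → notFull ∘ lv u) chain
      open FaceFromRanking vInW rank rank≤n rank-injective prefix-closed

    g = gluePattern

    toK : Vec ℕ n → Vec ℕ (suc (cuts g))
    toK u = blockCounts g (linear (shiftSet u))

    fromK : Vec ℕ (suc (cuts g)) → Vec ℕ n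
    fromK a = shiftBy (cyclic (finalSegments g a))

    upClosed : ∀ {u} → LinkVertex u → UpClosed g (linear (shiftSet u))
    upClosed lv = closed⇒upClosed _ (closed lv)

    finalSegments∘toK : ∀ {u} → LinkVertex u → finalSegments g (toK u) ≡ linear (shiftSet u)
    finalSegments∘toK lv = finalSegments∘blockCounts g _ (upClosed lv)

    linear-constant : ∀ S b → linear S ≡ replicate (suc n) b → ∀ p → S p ≡ b
    linear-constant S b eq p =
      trans (sym (cyclic-linear S p)) (trans (cong (λ X → lookup X (index p)) eq) (lookup-replicate (index p) b))

    constant-linear : ∀ S b → (∀ p → S p ≡ b) → linear S ≡ replicate (suc n) b
    constant-linear S b S≡b = lookup-ext _ _ (λ t → trans (lookup-linear S t) (trans (S≡b (at t)) (sym (lookup-replicate t b))))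

    linear-⊆ : ∀ S S′ → S ⊆ᵇ S′ → lookup (linear S) ⊆ᵇ lookup (linear S′)
    linear-⊆ S S′ S⊆S′ t h = trans (lookup-linear S′ t) (S⊆S′ (at t) (trans (sym (lookup-linear S t)) h))

    toK-inP° : ∀ {u} → LinkVertex u → InP° (blockSizes g) (toK u)
    toK-inP° {u} lv = blockCounts-≤ g _ , notBottom , notTop
      where
      constant : ∀ b → toK u ≡ blockCounts g (replicate (suc n) b) → ∀ p → shiftSet u p ≡ b
      constant b eq = linear-constant (shiftSet u) b (blockCounts-injective g (upClosed lv) (replicate-upClosed g b) eq)
      notBottom : toK u ≢ replicate _ 0
      notBottom eq = true≢false (trans (sym (proj₂ (notEmpty lv)))
                                       (constant false (trans eq (sym (blockCounts-empty g))) (proj₁ (notEmpty lv))))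
      notTop : toK u ≢ blockSizes g
      notTop eq = true≢false (sym (trans (sym (proj₂ (notFull lv)))
                                         (constant true (trans eq (sym (blockCounts-full g))) (proj₁ (notFull lv)))))

    toK-mono : ∀ u u′ → shiftSet u ⊆ᵇ shiftSet u′ → toK u ≤P toK u′
    toK-mono u u′ u⊆u′ = blockCounts-mono g _ _ (linear-⊆ _ _ u⊆u′)

    toK-reflects : ∀ {u u′} → LinkVertex u → LinkVertex u′ → toK u ≤P toK u′ → shiftSet u ⊆ᵇ shiftSet u′
    toK-reflects {u} {u′} lv lv′ le p h =
      trans (sym (cyclic-linear (shiftSet u′) p))
            (subst₂ (λ X Y → lookup X ⊆ᵇ lookup Y) (finalSegments∘toK lv) (finalSegments∘toK lv′)
                    (finalSegments-mono g _ _ le) (index p) (trans (cyclic-linear (shiftSet u) p) h))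

    fromK∘toK : ∀ {u} → LinkVertex u → fromK (toK u) ≡ u
    fromK∘toK {u} lv =
      trans (shiftBy-cong _ _ (λ p → trans (cong (λ X → cyclic X p) (finalSegments∘toK lv)) (cyclic-linear (shiftSet u) p)))
            (Shift-unique (shiftSet u) _ _ (shiftBy-Shift asc (shiftSet u) (closed lv)) (shift lv))
      where asc = InW⇒Ascending v vInW

    module FromK (a : Vec ℕ (suc (cuts g))) (a∈P° : InP° (blockSizes g) a) where

      asc = InW⇒Ascending v vInW
      X = finalSegments g a
      S = cyclic X
      closedS : Closed S
      closedS = upClosed⇒closed X (finalSegments-upClosed g a)
      u = fromK a
      sh : Shift S u
      sh = shiftBy-Shift asc S closedS

      counts : blockCounts g X ≡ a
      counts = blockCounts∘finalSegments g a (proj₁ a∈P°)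

      -- S is constant only at the bottom and the top of P_λ, and a constant
      -- shift fixes v.
      u≢v : u ≢ v
      u≢v u≡v = excluded (S zero) refl
        where
        X≡replicate : ∀ b → S zero ≡ b → X ≡ replicate (suc n) b
        X≡replicate b S0≡b = trans (sym (linear-cyclic X)) (constant-linear S b λ
          { zero    → S0≡b
          ; (suc i) → trans (Shift-self⇒constant S (subst (Shift S) u≡v sh) i) S0≡b })
        excluded : ∀ b → S zero ≡ b → ⊥
        excluded false S0 = proj₁ (proj₂ a∈P°)
          (trans (sym counts) (trans (cong (blockCounts g) (X≡replicate false S0)) (blockCounts-empty g)))
        excluded true  S0 = proj₂ (proj₂ a∈P°)
          (trans (sym counts) (trans (cong (blockCounts g) (X≡replicate true S0)) (blockCounts-full g)))

      linkVertexOf = linkVertex S u sh (Ascending⇒InW _ (shiftBy-ascending asc S closedS)) u≢v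

      vertex : Vertex (link (T (suc n) q) v) u
      vertex = (λ { (here v≡u) → u≢v (sym v≡u) })
             , chain⇒face (u ∷ []) (λ { _ (here refl) → proj₁ linkVertexOf })
                                     (λ { _ _ (here refl) (here refl) → inj₁ (λ _ h → h) })

      toK∘fromK : toK u ≡ a
      toK∘fromK = trans (cong (blockCounts g) (trans (tabulate-cong (proj₂ linkVertexOf ∘ at)) (linear-cyclic X))) counts

    linkFace⇒KFace : ∀ σ → (∀ {u} → u ∈ σ → LinkVertex u) → Face (link (T (suc n) q) v) σ →
                     Face (K (suc (cuts g)) (blockSizes g)) (List.map toK σ)
    linkFace⇒KFace σ lv face = map⁺ (All.tabulate (toK-inP° ∘ lv)) , chain
      where
      chain : ∀ {a b} → a ∈ List.map toK σ → b ∈ List.map toK σ → a ≤P b ⊎ b ≤P a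
      chain a∈ b∈ with ∈-map⁻ toK a∈ | ∈-map⁻ toK b∈
      ... | u , u∈σ , refl | u′ , u′∈σ , refl =
        Sum.map (toK-mono u u′) (toK-mono u′ u) (linkFace⇒chain face u∈σ u′∈σ)

    KFace⇒linkFace : ∀ σ → All (Vertex (link (T (suc n) q) v)) σ →
                     Face (K (suc (cuts g)) (blockSizes g)) (List.map toK σ) → Face (link (T (suc n) q) v) σ
    KFace⇒linkFace σ vertices (_ , chain) = v∉σ , chain⇒face σ (λ _ → lv) chain′
      where
      lv : ∀ {u} → u ∈ σ → LinkVertex u
      lv = vertex⇒LinkVertex ∘ All.lookup vertices
      v∉σ : v ∉ σ
      v∉σ v∈σ = proj₁ (All.lookup vertices v∈σ) (here refl)
      chain′ : ∀ u u′ → u ∈ σ → u′ ∈ σ → shiftSet u ⊆ᵇ shiftSet u′ ⊎ shiftSet u′ ⊆ᵇ shiftSet u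
      chain′ u u′ u∈σ u′∈σ = Sum.map (toK-reflects (lv u∈σ) (lv u′∈σ)) (toK-reflects (lv u′∈σ) (lv u∈σ))
                                     (chain (∈-map⁺ toK u∈σ) (∈-map⁺ toK u′∈σ))

    linkIso : link (T (suc n) q) v ≅ K (suc (cuts g)) (blockSizes g)
    linkIso = record
      { to        = toK
      ; from      = fromK
      ; to-vert   = λ u vx → (toK-inP° (vertex⇒LinkVertex vx) All.∷ All.[])
                           , λ { (here refl) (here refl) → inj₁ (λ _ → ≤-refl) }
      ; from-vert = λ a ka → FromK.vertex a (All.head (proj₁ ka))
      ; from-to   = λ u vx → fromK∘toK (vertex⇒LinkVertex vx)
      ; to-from   = λ a ka → FromK.toK∘fromK a (All.head (proj₁ ka))
      ; face-iff  = λ σ vertices → mk⇔ (linkFace⇒KFace σ (vertex⇒LinkVertex ∘ All.lookup vertices))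
                                       (KFace⇒linkFace σ vertices)
      }

-- Permuting the chains of P_λ

≅-trans : ∀ {A B C} → A ≅ B → B ≅ C → A ≅ C
≅-trans {A} {B} {C} f g = record
  { to        = G.to ∘ F.to
  ; from      = F.from ∘ G.from
  ; to-vert   = λ a va → G.to-vert _ (F.to-vert a va)
  ; from-vert = λ c vc → F.from-vert _ (G.from-vert c vc)
  ; from-to   = λ a va → trans (cong F.from (G.from-to _ (F.to-vert a va))) (F.from-to a va)
  ; to-from   = λ c vc → trans (cong G.to (F.to-from _ (G.from-vert c vc))) (G.to-from c vc)
  ; face-iff  = λ σ vertices →
      let f⇔ = F.face-iff σ vertices
          g⇔ = G.face-iff (List.map F.to σ) (map⁺ (All.map (F.to-vert _) vertices))
      in mk⇔ (subst (Face C) (sym (map-∘ σ)) ∘ Equivalence.to g⇔ ∘ Equivalence.to f⇔)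
             (Equivalence.from f⇔ ∘ Equivalence.from g⇔ ∘ subst (Face C) (map-∘ σ))
  }
  where
  module F = _≅_ f
  module G = _≅_ g

permute : ∀ {s} → Permutation′ s → Vec ℕ s → Vec ℕ s
permute π a = tabulate (lookup a ∘ (π ⟨$⟩ʳ_))

module _ {s} (π : Permutation′ s) where

  lookup-permute : ∀ a i → lookup (permute π a) i ≡ lookup a (π ⟨$⟩ʳ i)
  lookup-permute a = lookup∘tabulate (lookup a ∘ (π ⟨$⟩ʳ_))

  permute-flip : ∀ a → permute (flip π) (permute π a) ≡ a
  permute-flip a = lookup-ext _ _ λ i →
    trans (lookup∘tabulate _ i) (trans (lookup-permute a _) (cong (lookup a) (inverseʳ π)))

  permute-replicate : ∀ x → permute π (replicate s x) ≡ replicate s x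
  permute-replicate x = lookup-ext _ _ λ i →
    trans (lookup-permute (replicate s x) i) (trans (lookup-replicate (π ⟨$⟩ʳ i) x) (sym (lookup-replicate i x)))

  permute-mono : ∀ a b → a ≤P b → permute π a ≤P permute π b
  permute-mono a b a≤b i = subst₂ _≤_ (sym (lookup-permute a i)) (sym (lookup-permute b i)) (a≤b _)

permute-flip′ : ∀ {s} (π : Permutation′ s) a → permute π (permute (flip π) a) ≡ a
permute-flip′ π = permute-flip (flip π)

permute-reflects : ∀ {s} (π : Permutation′ s) a b → permute π a ≤P permute π b → a ≤P b
permute-reflects π a b le =
  subst₂ _≤P_ (permute-flip π a) (permute-flip π b) (permute-mono (flip π) (permute π a) (permute π b) le)

permute-interior : ∀ {s} (π : Permutation′ s) {lam a} → InP° lam a → InP° (permute π lam) (permute π a)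
permute-interior {s} π {lam} {a} (a≤lam , a≢0 , a≢lam) =
  permute-mono π a lam a≤lam ,
  (λ eq → a≢0 (trans (sym (permute-flip π a)) (trans (cong (permute (flip π)) eq) (permute-replicate (flip π) 0)))) ,
  (λ eq → a≢lam (trans (sym (permute-flip π a)) (trans (cong (permute (flip π)) eq) (permute-flip π lam))))

permuteIso : ∀ {s} (π : Permutation′ s) (lam : Vec ℕ s) → K s lam ≅ K s (permute π lam)
permuteIso {s} π lam = record
  { to        = permute π
  ; from      = permute (flip π)
  ; to-vert   = λ a va → singleton (permute-interior π (All.head (proj₁ va)))
  ; from-vert = λ b vb → singleton (subst (λ l → InP° l (permute (flip π) b)) (permute-flip π lam)
                                          (permute-interior (flip π) (All.head (proj₁ vb))))
  ; from-to   = λ a _ → permute-flip π a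
  ; to-from   = λ b _ → permute-flip′ π b
  ; face-iff  = λ σ vertices → mk⇔
      (λ (interior , chain) → map⁺ (All.map (permute-interior π) interior) , λ a∈ b∈ → chain-to σ chain a∈ b∈)
      (λ (_ , chain) → All.map (All.head ∘ proj₁) vertices , λ a∈ b∈ → chain-from σ chain a∈ b∈)
  }
  where
  singleton : ∀ {l a} → InP° l a → Face (K s l) (a ∷ [])
  singleton a° = (a° All.∷ All.[]) , λ { (here refl) (here refl) → inj₁ (λ _ → ≤-refl) }
  chain-to : ∀ σ → (∀ {a b} → a ∈ σ → b ∈ σ → a ≤P b ⊎ b ≤P a) →
             ∀ {a b} → a ∈ List.map (permute π) σ → b ∈ List.map (permute π) σ → a ≤P b ⊎ b ≤P a
  chain-to σ chain a∈ b∈ with ∈-map⁻ (permute π) a∈ | ∈-map⁻ (permute π) b∈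
  ... | a , a∈σ , refl | b , b∈σ , refl = Sum.map (permute-mono π a b) (permute-mono π b a) (chain a∈σ b∈σ)
  chain-from : ∀ σ → (∀ {a b} → a ∈ List.map (permute π) σ → b ∈ List.map (permute π) σ → a ≤P b ⊎ b ≤P a) →
               ∀ {a b} → a ∈ σ → b ∈ σ → a ≤P b ⊎ b ≤P a
  chain-from σ chain {a} {b} a∈σ b∈σ =
    Sum.map (permute-reflects π a b) (permute-reflects π b a)
            (chain (∈-map⁺ (permute π) a∈σ) (∈-map⁺ (permute π) b∈σ))

Rearrangement : ∀ {s} → Vec ℕ s → Vec ℕ s → Set
Rearrangement {s} a b = Σ (Permutation′ s) λ π → b ≡ permute π a

rearrangement-refl : ∀ {s} (a : Vec ℕ s) → Rearrangement a a
rearrangement-refl a = Perm.id , sym (tabulate∘lookup a)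

rearrangement-trans : ∀ {s} {a b c : Vec ℕ s} → Rearrangement a b → Rearrangement b c → Rearrangement a c
rearrangement-trans {a = a} (π , b≡) (ρ , c≡) =
  ρ ∘ₚ π , trans c≡ (trans (cong (permute ρ) b≡) (tabulate-cong (λ i → lookup-permute π a (ρ ⟨$⟩ʳ i))))

rearrangement-cons : ∀ {s} x {a b : Vec ℕ s} → Rearrangement a b → Rearrangement (x ∷ a) (x ∷ b)
rearrangement-cons x (π , b≡) = lift₀ π , cong (x ∷_) b≡

rearrangement-swap : ∀ {s} x y (a : Vec ℕ s) → Rearrangement (x ∷ y ∷ a) (y ∷ x ∷ a)
rearrangement-swap x y a = transpose zero (suc zero) , cong (λ z → y ∷ x ∷ z) (sym (tabulate∘lookup a))

insert : ∀ {m} → ℕ → Vec ℕ m → Vec ℕ (suc m)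
insert x []       = x ∷ []
insert x (y ∷ ys) with y ≤? x
... | yes _ = x ∷ y ∷ ys
... | no _  = y ∷ insert x ys

sort : ∀ {m} → Vec ℕ m → Vec ℕ m
sort []       = []
sort (x ∷ xs) = insert x (sort xs)

insert-rearrangement : ∀ {m} x (ys : Vec ℕ m) → Rearrangement (x ∷ ys) (insert x ys)
insert-rearrangement x []       = rearrangement-refl _
insert-rearrangement x (y ∷ ys) with y ≤? x
... | yes _ = rearrangement-refl _
... | no _  = rearrangement-trans {a = x ∷ y ∷ ys} (rearrangement-swap x y ys)
                                  (rearrangement-cons y (insert-rearrangement x ys))

sort-rearrangement : ∀ {m} (xs : Vec ℕ m) → Rearrangement xs (sort xs)
sort-rearrangement []       = rearrangement-refl _
sort-rearrangement (x ∷ xs) =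
  rearrangement-trans {a = x ∷ xs} (rearrangement-cons x (sort-rearrangement xs)) (insert-rearrangement x (sort xs))

insert-descending : ∀ {m} x (ys : Vec ℕ m) → Linked _≥_ ys → Linked _≥_ (insert x ys)
insert-descending x []       _ = [-]
insert-descending x (y ∷ ys) desc with y ≤? x
... | yes y≤x = y≤x ∷ desc
... | no y≰x  = below ys desc
  where
  below : ∀ {m} (ys : Vec ℕ m) → Linked _≥_ (y ∷ ys) → Linked _≥_ (y ∷ insert x ys)
  below []       _ = <⇒≤ (≰⇒> y≰x) ∷ [-]
  below (z ∷ zs) (z≤y ∷ desc′) with z ≤? x | insert-descending x (z ∷ zs) desc′
  ... | yes _ | rest = <⇒≤ (≰⇒> y≰x) ∷ rest
  ... | no _  | rest = z≤y ∷ rest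

sort-descending : ∀ {m} (xs : Vec ℕ m) → Linked _≥_ (sort xs)
sort-descending []       = []
sort-descending (x ∷ xs) = insert-descending x (sort xs) (sort-descending xs)

descending-Succ : ∀ {m} {xs : Vec ℕ m} → Linked _≥_ xs → ∀ i j → Succ i j → lookup xs j ≤ lookup xs i
descending-Succ desc i j s =
  Linked.lookup⁺ (λ x≥y y≥z → ≤-trans y≥z x≥y) desc (subst (toℕ i <_) (sym s) (n<1+n (toℕ i)))

sum-insert : ∀ {m} x (ys : Vec ℕ m) → sum (insert x ys) ≡ x + sum ys
sum-insert x []       = refl
sum-insert x (y ∷ ys) with y ≤? x
... | yes _ = refl
... | no _  = trans (cong (y +_) (sum-insert x ys)) (x+y+z≡y+x+z y x (sum ys))
  where
  x+y+z≡y+x+z : ∀ a b c → a + (b + c) ≡ b + (a + c)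
  x+y+z≡y+x+z a b c = trans (sym (+-assoc a b c)) (trans (cong (_+ c) (+-comm a b)) (+-assoc b a c))

sum-sort : ∀ {m} (xs : Vec ℕ m) → sum (sort xs) ≡ sum xs
sum-sort []       = refl
sum-sort (x ∷ xs) = trans (sum-insert x (sort xs)) (cong (x +_) (sum-sort xs))

sort-positive : ∀ {m} (xs : Vec ℕ m) → (∀ i → 1 ≤ lookup xs i) → ∀ i → 1 ≤ lookup (sort xs) i
sort-positive xs pos i with sort-rearrangement xs
... | π , sorted≡ rewrite sorted≡ = subst (1 ≤_) (sym (lookup-permute π xs i)) (pos _)

sortIso : ∀ {s} (lam : Vec ℕ s) → K s lam ≅ K s (sort lam)
sortIso lam with sort-rearrangement lam
... | π , sorted≡ = subst (λ b → K _ lam ≅ K _ b) (sym sorted≡) (permuteIso π lam)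

sort-isPar : ∀ {k s} (lam : Vec ℕ s) → (∀ i → 1 ≤ lookup lam i) → sum lam ≡ k → IsPar k s (sort lam)
sort-isPar lam pos sum≡k = descending-Succ (sort-descending lam) , sort-positive lam pos , trans (sum-sort lam) sum≡k

-- Cutting the cycle after an unglued gap

%-absorbˡ : ∀ m k n → (m % suc n + k) % suc n ≡ (m + k) % suc n
%-absorbˡ m k n = trans (%-distribˡ-+ (m % suc n) k (suc n))
                        (trans (cong (λ z → (z + k % suc n) % suc n) (m%n%n≡m%n m (suc n))) (sym (%-distribˡ-+ m k (suc n))))

suc-% : ∀ m n → suc (m % suc n) % suc n ≡ suc m % suc n
suc-% m n = trans (cong (_% suc n) (+-comm 1 (m % suc n))) (trans (%-absorbˡ m 1 n) (cong (_% suc n) (+-comm m 1)))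

+-% : ∀ t n → t ≤ n → (t + suc n) % suc n ≡ t
+-% t n t≤n = trans ([m+n]%n≡m%n t (suc n)) (m≤n⇒m%n≡m t≤n)

cuts-cons : ∀ {n} b (g : Vec Bool n) → cuts (b ∷ g) ≡ bit (not b) + cuts g
cuts-cons true  g = refl
cuts-cons false g = refl

cuts-telescope : ∀ {n} (h : ℕ → ℕ) (b : ℕ → Bool) → (∀ x → x < n → h x + bit (not (b x)) ≤ h (suc x)) →
                 h 0 + cuts (tabulate {n = n} (b ∘ toℕ)) ≤ h n
cuts-telescope {zero}  h b step = ≤-reflexive (+-identityʳ _)
cuts-telescope {suc n} h b step = begin
  h 0 + cuts (b 0 ∷ rest)                 ≡⟨ cong (h 0 +_) (cuts-cons (b 0) rest) ⟩
  h 0 + (bit (not (b 0)) + cuts rest)     ≡⟨ +-assoc (h 0) _ _ ⟨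
  h 0 + bit (not (b 0)) + cuts rest       ≤⟨ +-monoˡ-≤ (cuts rest) (step 0 (s≤s z≤n)) ⟩
  h 1 + cuts rest                         ≤⟨ cuts-telescope (h ∘ suc) (b ∘ suc) (λ x x<n → step (suc x) (s≤s x<n)) ⟩
  h (suc n)                               ∎
  where
  open ≤-Reasoning
  rest = tabulate {n = n} (b ∘ suc ∘ toℕ)

module CutAfter {n : ℕ} (q : ℕ) (v : Vec ℕ n) (c₀ : Fin (suc n)) (unglued : Around.glued q v c₀ ≡ false) where

  open Around q v

  c a : ℕ
  c = toℕ c₀
  a = n ∸ c

  c≤n : c ≤ n
  c≤n = s≤s⁻¹ (toℕ<n c₀)

  1+c+a : suc c + a ≡ suc n
  1+c+a = cong suc (m+[n∸m]≡n c≤n)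

  -- Row position x is the gap x + c + 1 (mod n + 1), so the row ends with c₀.
  rowPos : ℕ → Pos
  rowPos x = fromℕ< (m%n<n (x + suc c) (suc n))

  toℕ-rowPos : ∀ x → toℕ (rowPos x) ≡ (x + suc c) % suc n
  toℕ-rowPos x = toℕ-fromℕ< _

  next-rowPos : ∀ x → next (rowPos x) ≡ rowPos (suc x)
  next-rowPos x = toℕ-injective (begin
    toℕ (next (rowPos x))            ≡⟨ toℕ-next (rowPos x) ⟩
    suc (toℕ (rowPos x)) % suc n     ≡⟨ cong (λ z → suc z % suc n) (toℕ-rowPos x) ⟩
    suc ((x + suc c) % suc n) % suc n ≡⟨ suc-% (x + suc c) n ⟩
    (suc x + suc c) % suc n          ≡⟨ toℕ-rowPos (suc x) ⟨
    toℕ (rowPos (suc x))             ∎)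
    where open ≡-Reasoning

  rowPos-n : rowPos n ≡ c₀
  rowPos-n = toℕ-injective (trans (toℕ-rowPos n)
    (trans (cong (_% suc n) (trans (+-comm n (suc c)) (sym (+-suc c n)))) (+-% c n c≤n)))

  index : Pos → Fin (suc n)
  index p = fromℕ< (m%n<n (toℕ p + a) (suc n))

  index-rowPos : ∀ t → index (rowPos (toℕ t)) ≡ t
  index-rowPos t = toℕ-injective (begin
    toℕ (index (rowPos (toℕ t)))          ≡⟨ toℕ-fromℕ< _ ⟩
    (toℕ (rowPos (toℕ t)) + a) % suc n     ≡⟨ cong (λ z → (z + a) % suc n) (toℕ-rowPos (toℕ t)) ⟩
    ((toℕ t + suc c) % suc n + a) % suc n ≡⟨ %-absorbˡ (toℕ t + suc c) a n ⟩
    (toℕ t + suc c + a) % suc n           ≡⟨ cong (_% suc n) (trans (+-assoc (toℕ t) (suc c) a) (cong (toℕ t +_) 1+c+a)) ⟩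
    (toℕ t + suc n) % suc n               ≡⟨ +-% (toℕ t) n (s≤s⁻¹ (toℕ<n t)) ⟩
    toℕ t                                 ∎)
    where open ≡-Reasoning

  rowPos-index : ∀ p → rowPos (toℕ (index p)) ≡ p
  rowPos-index p = toℕ-injective (begin
    toℕ (rowPos (toℕ (index p)))              ≡⟨ toℕ-rowPos (toℕ (index p)) ⟩
    (toℕ (index p) + suc c) % suc n           ≡⟨ cong (λ z → (z + suc c) % suc n) (toℕ-fromℕ< (m%n<n (toℕ p + a) (suc n))) ⟩
    ((toℕ p + a) % suc n + suc c) % suc n     ≡⟨ %-absorbˡ (toℕ p + a) (suc c) n ⟩
    (toℕ p + a + suc c) % suc n               ≡⟨ cong (_% suc n) (+-assoc (toℕ p) a (suc c)) ⟩
    (toℕ p + (a + suc c)) % suc n             ≡⟨ cong (λ z → (toℕ p + z) % suc n) (trans (+-comm a (suc c)) 1+c+a) ⟩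
    (toℕ p + suc n) % suc n                   ≡⟨ +-% (toℕ p) n (s≤s⁻¹ (toℕ<n p)) ⟩
    toℕ p                                     ∎)
    where open ≡-Reasoning

  rowGlued : ℕ → Bool
  rowGlued x = glued (rowPos x)

  cut : Cut
  cut = record
    { gluePattern  = tabulate (rowGlued ∘ toℕ)
    ; at           = rowPos ∘ toℕ
    ; index        = index
    ; index-at     = index-rowPos
    ; at-index     = rowPos-index
    ; glued-at     = λ t → trans (cong rowGlued (toℕ-inject₁ t)) (sym (lookup∘tabulate (rowGlued ∘ toℕ) t))
    ; next-at      = λ t → trans (cong (next ∘ rowPos) (toℕ-inject₁ t)) (next-rowPos (toℕ t))
    ; last-unglued = trans (cong rowGlued (toℕ-fromℕ n)) (trans (cong glued rowPos-n) unglued)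
    }

  toℕ-rowPos-before : ∀ {x} → x < a → toℕ (rowPos x) ≡ x + suc c
  toℕ-rowPos-before {x} x<a = trans (toℕ-rowPos x) (m≤n⇒m%n≡m x+1+c≤n)
    where
    x+1+c≤n : x + suc c ≤ n
    x+1+c≤n = subst₂ _≤_ (sym (+-suc x c)) (m∸n+n≡m c≤n) (+-monoˡ-≤ c x<a)

  toℕ-rowPos-after : ∀ {x} → a ≤ x → x ≤ n → toℕ (rowPos x) ≡ x ∸ a
  toℕ-rowPos-after {x} a≤x x≤n =
    trans (toℕ-rowPos x) (trans (cong (_% suc n) unwrap) (+-% (x ∸ a) n (≤-trans (m∸n≤m x a) x≤n)))
    where
    unwrap : x + suc c ≡ x ∸ a + suc n
    unwrap = trans (cong (_+ suc c) (sym (m∸n+n≡m a≤x)))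
                   (trans (+-assoc (x ∸ a) a (suc c)) (cong (x ∸ a +_) (trans (+-comm a (suc c)) 1+c+a)))

  offset : ℕ → ℕ
  offset x with x <? a
  ... | yes _ = 0
  ... | no _  = q

  offset-before : ∀ {x} → x < a → offset x ≡ 0
  offset-before {x} x<a with x <? a
  ... | yes _  = refl
  ... | no x≮a = ⊥-elim (x≮a x<a)

  offset-after : ∀ {x} → a ≤ x → offset x ≡ q
  offset-after {x} a≤x with x <? a
  ... | yes x<a = ⊥-elim (<⇒≱ x<a a≤x)
  ... | no _    = refl

  -- The height of row position x in the sequence 0, v, q continued periodically
  -- by adding q once the row has passed the end of the cycle.
  lifted : ℕ → ℕ
  lifted x = padded v (rowPos x) + offset x

  module _ (asc : Ascending v) where

    unglued-gap : ∀ p → padded v p + bit (not (glued p)) ≤ paddedNext v p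
    unglued-gap p with glued p in gl
    ... | true  = ≤-trans (≤-reflexive (+-identityʳ _)) (asc p)
    ... | false = subst (_≤ paddedNext v p) (+-comm 1 _)
                        (≤∧≢⇒< (asc p) (λ eq → true≢false (trans (sym (glued-intro p eq)) gl)))

    inner-step : ∀ x → toℕ (rowPos x) < n → padded v (rowPos x) + bit (not (rowGlued x)) ≤ padded v (rowPos (suc x))
    inner-step x inner = subst (padded v (rowPos x) + bit (not (rowGlued x)) ≤_)
                               (trans (paddedNext-inner v _ inner) (cong (padded v) (next-rowPos x)))
                               (unglued-gap (rowPos x))

    with-offset : ∀ x {z} o → padded v (rowPos x) + bit (not (rowGlued x)) ≤ z →
                  padded v (rowPos x) + o + bit (not (rowGlued x)) ≤ z + o
    with-offset x {z} o le = subst (_≤ z + o) (trans (+-assoc h b o) (trans (cong (h +_) (+-comm b o)) (sym (+-assoc h o b))))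
                                   (+-monoˡ-≤ o le)
      where
      h = padded v (rowPos x)
      b = bit (not (rowGlued x))

    lifted-step : ∀ x → x < n → lifted x + bit (not (rowGlued x)) ≤ lifted (suc x)
    lifted-step x x<n with <⊎≥ (suc x) a | <⊎≥ x a
    ... | inj₁ x+1<a | _
      rewrite offset-before (<-trans (n<1+n x) x+1<a) | offset-before x+1<a = with-offset x 0 (inner-step x inner)
      where
      x<a = <-trans (n<1+n x) x+1<a
      inner : toℕ (rowPos x) < n
      inner = subst (_< n) (sym (toℕ-rowPos-before x<a))
                    (subst₂ _≤_ (cong suc (sym (+-suc x c))) (m∸n+n≡m c≤n) (+-monoˡ-≤ c x+1<a))
    ... | inj₂ a≤x+1 | inj₁ x<a
      rewrite offset-before x<a | offset-after a≤x+1 | +-identityʳ (padded v (rowPos x)) =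
        ≤-trans (unglued-gap (rowPos x)) (≤-trans (≤-reflexive (paddedNext-last v _ last)) (m≤n+m q _))
      where
      last : ¬ (toℕ (rowPos x) < n)
      last = <-irrefl (trans (toℕ-rowPos-before x<a)
                             (trans (+-suc x c) (trans (cong (_+ c) (≤-antisym x<a a≤x+1)) (m∸n+n≡m c≤n))))
    ... | inj₂ a≤x+1 | inj₂ a≤x
      rewrite offset-after a≤x | offset-after a≤x+1 = with-offset x q (inner-step x inner)
      where
      inner : toℕ (rowPos x) < n
      inner = subst (_< n) (sym (toℕ-rowPos-after a≤x (<⇒≤ x<n))) (≤-<-trans (m∸n≤m x a) x<n)

    lifted-first : lifted 0 ≡ paddedNext v c₀
    lifted-first with <⊎≥ 0 a
    ... | inj₁ 0<a = trans (cong₂ _+_ (cong (padded v) first) (offset-before 0<a))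
                           (trans (+-identityʳ _) (sym (paddedNext-inner v c₀ c<n)))
      where
      c<n : c < n
      c<n = subst (suc c ≤_) (m∸n+n≡m c≤n) (+-monoˡ-≤ c 0<a)
      first : rowPos 0 ≡ next c₀
      first = toℕ-injective (trans (toℕ-rowPos-before 0<a) (sym (next-inner c₀ c<n)))
    ... | inj₂ a≤0 = trans (cong₂ _+_ (cong (padded v) first) (offset-after a≤0)) (sym (paddedNext-last v c₀ c≮n))
      where
      c≮n : ¬ (c < n)
      c≮n c<n = <⇒≱ (m<n⇒0<n∸m c<n) a≤0
      first : rowPos 0 ≡ zero
      first = toℕ-injective (trans (toℕ-rowPos-after {0} a≤0 z≤n) (0∸n≡0 a))

    lifted-last : lifted n ≡ padded v c₀ + q
    lifted-last = cong₂ _+_ (cong (padded v) rowPos-n) (offset-after (m∸n≤m n c))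

    -- Every cut of the row, and the unglued gap at its end, adds at least one to the height.
    blocks≤q : suc (cuts (tabulate {n = n} (rowGlued ∘ toℕ))) ≤ q
    blocks≤q = +-cancelˡ-≤ (padded v c₀) _ _ (begin
      padded v c₀ + suc (cuts g)               ≡⟨ +-suc _ _ ⟩
      suc (padded v c₀) + cuts g               ≡⟨ cong (λ z → z + cuts g) (+-comm 1 _) ⟩
      padded v c₀ + bit (not false) + cuts g   ≡⟨ cong (λ b → padded v c₀ + bit (not b) + cuts g) unglued ⟨
      padded v c₀ + bit (not (glued c₀)) + cuts g ≤⟨ +-monoˡ-≤ _ (unglued-gap c₀) ⟩
      paddedNext v c₀ + cuts g                 ≡⟨ cong (_+ cuts g) lifted-first ⟨
      lifted 0 + cuts g                        ≤⟨ cuts-telescope lifted rowGlued lifted-step ⟩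
      lifted n                                 ≡⟨ lifted-last ⟩
      padded v c₀ + q                          ∎)
      where
      open ≤-Reasoning
      g = tabulate {n = n} (rowGlued ∘ toℕ)

-- With all gaps glued, every entry of 0, v, q would equal its predecessor.
unglued-exists : ∀ {n} q (v : Vec ℕ n) → 1 ≤ q → ∃ λ p → Around.glued q v p ≡ false
unglued-exists {n} q v 1≤q with any? (λ p → glued p ≟ᵇ false)
  where open Around q v
... | yes found    = found
... | no ¬found = ⊥-elim (<-irrefl (sym q≡0) 1≤q)
  where
  open Around q v
  allGlued : ∀ p → glued p ≡ true
  allGlued p with glued p in gl
  ... | true  = refl
  ... | false = ⊥-elim (¬found (p , gl))
  flat : ∀ p → padded v p ≡ 0
  flat = next-induction _ refl λ p p<n p≡0 →
    trans (sym (paddedNext-inner v p p<n)) (trans (sym (≡ᵇ-true (allGlued p))) p≡0)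
  q≡0 : q ≡ 0
  q≡0 = trans (sym (paddedNext-last v (fromℕ n) (<-irrefl (toℕ-fromℕ n))))
              (trans (sym (≡ᵇ-true (allGlued (fromℕ n)))) (flat (fromℕ n)))

-- Realising a glue pattern

cutsBefore : ∀ {n} → Vec Bool n → ℕ → ℕ
cutsBefore []      _       = 0
cutsBefore (b ∷ g) zero    = 0
cutsBefore (b ∷ g) (suc j) = bit (not b) + cutsBefore g j

cutsBefore-zero : ∀ {n} (g : Vec Bool n) → cutsBefore g 0 ≡ 0
cutsBefore-zero []      = refl
cutsBefore-zero (b ∷ g) = refl

cutsBefore-suc : ∀ {n} (g : Vec Bool n) (t : Fin n) →
                 cutsBefore g (suc (toℕ t)) ≡ cutsBefore g (toℕ t) + bit (not (lookup g t))
cutsBefore-suc (b ∷ g) zero    = trans (cong (bit (not b) +_) (cutsBefore-zero g)) (+-comm (bit (not b)) 0)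
cutsBefore-suc (b ∷ g) (suc t) = trans (cong (bit (not b) +_) (cutsBefore-suc g t)) (sym (+-assoc (bit (not b)) _ _))

cutsBefore-all : ∀ {n} (g : Vec Bool n) → cutsBefore g n ≡ cuts g
cutsBefore-all []      = refl
cutsBefore-all (b ∷ g) = trans (cong (bit (not b) +_) (cutsBefore-all g)) (sym (cuts-cons b g))

≡ᵇ-+bit : ∀ x b → (x ≡ᵇ x + bit (not b)) ≡ b
≡ᵇ-+bit zero    true  = refl
≡ᵇ-+bit zero    false = refl
≡ᵇ-+bit (suc x) b     = ≡ᵇ-+bit x b

≡ᵇ-< : ∀ {x y} → x < y → (x ≡ᵇ y) ≡ false
≡ᵇ-< {zero}  {suc y} _       = refl
≡ᵇ-< {suc x} {suc y} (s≤s l) = ≡ᵇ-< l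

-- The point of W_{k,q} whose gaps are 1 at the cuts of g, 0 at its glued
-- steps, and whatever remains of q at the end.
module Realise {n : ℕ} (q : ℕ) (g : Vec Bool n) (blocks≤q : suc (cuts g) ≤ q) where

  v : Vec ℕ n
  v = tabulate (λ i → cutsBefore g (suc (toℕ i)))

  open Around q v

  padded-v : ∀ p → padded v p ≡ cutsBefore g (toℕ p)
  padded-v zero    = sym (cutsBefore-zero g)
  padded-v (suc i) = lookup∘tabulate (λ i → cutsBefore g (suc (toℕ i))) i

  inject₁<n : ∀ (t : Fin n) → toℕ (inject₁ t) < n
  inject₁<n t = subst (_< n) (sym (toℕ-inject₁ t)) (toℕ<n t)

  next-inject₁ : ∀ (t : Fin n) → next (inject₁ t) ≡ suc t
  next-inject₁ t = toℕ-injective (trans (next-inner (inject₁ t) (inject₁<n t)) (cong suc (toℕ-inject₁ t)))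

  glued-inject₁ : ∀ (t : Fin n) → glued (inject₁ t) ≡ lookup g t
  glued-inject₁ t = trans (cong₂ _≡ᵇ_ (trans (padded-v (inject₁ t)) (cong (cutsBefore g) (toℕ-inject₁ t)))
                                      (trans (paddedNext-inner v (inject₁ t) (inject₁<n t))
                                             (trans (cong (padded v) (next-inject₁ t))
                                                    (trans (padded-v (suc t)) (cutsBefore-suc g t)))))
                          (≡ᵇ-+bit (cutsBefore g (toℕ t)) (lookup g t))

  last-unglued : glued (fromℕ n) ≡ false
  last-unglued = trans (cong₂ _≡ᵇ_ (trans (padded-v (fromℕ n)) (trans (cong (cutsBefore g) (toℕ-fromℕ n)) (cutsBefore-all g)))
                                   (paddedNext-last v (fromℕ n) (<-irrefl (toℕ-fromℕ n))))
                       (≡ᵇ-< blocks≤q)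

  ascending : Ascending v
  ascending p with <⊎≥ (toℕ p) n
  ... | inj₁ p<n = subst₂ _≤_ (sym (padded-v p)) (sym nextEntry) (growing (toℕ p) p<n)
    where
    nextEntry : paddedNext v p ≡ cutsBefore g (suc (toℕ p))
    nextEntry = trans (paddedNext-inner v p p<n) (trans (padded-v (next p)) (cong (cutsBefore g) (next-inner p p<n)))
    growing : ∀ x → x < n → cutsBefore g x ≤ cutsBefore g (suc x)
    growing x x<n = subst (λ z → cutsBefore g z ≤ cutsBefore g (suc z)) (toℕ-fromℕ< x<n)
                          (subst (cutsBefore g (toℕ (fromℕ< x<n)) ≤_) (sym (cutsBefore-suc g (fromℕ< x<n))) (m≤m+n _ _))
  ... | inj₂ n≤p = subst₂ _≤_ (sym (padded-v p)) (sym (paddedNext-last v p (λ p<n → <⇒≱ p<n n≤p)))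
                              (subst (λ z → cutsBefore g z ≤ q) (sym p≡n)
                                     (subst (_≤ q) (sym (cutsBefore-all g)) (≤-trans (n≤1+n _) blocks≤q)))
    where
    p≡n : toℕ p ≡ n
    p≡n = ≤-antisym (s≤s⁻¹ (toℕ<n p)) n≤p

  vInW : InW q v
  vInW = Ascending⇒InW v ascending

  open CutAfter q v (fromℕ n) last-unglued using (cut; rowPos; toℕ-rowPos; rowGlued)
  open LinkIso vInW cut using (linkIso; chain⇒face)

  rowPos-toℕ : ∀ (t : Fin (suc n)) → rowPos (toℕ t) ≡ t
  rowPos-toℕ t = toℕ-injective (trans (toℕ-rowPos (toℕ t))
    (trans (cong (λ c → (toℕ t + suc c) % suc n) (toℕ-fromℕ n)) (+-% (toℕ t) n (s≤s⁻¹ (toℕ<n t)))))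

  gluePattern≡g : Cut.gluePattern cut ≡ g
  gluePattern≡g = lookup-ext _ _ λ t →
    trans (lookup∘tabulate (rowGlued ∘ toℕ) t)
          (trans (cong glued (trans (cong rowPos (sym (toℕ-inject₁ t))) (rowPos-toℕ (inject₁ t)))) (glued-inject₁ t))

  vertex : Vertex (T (suc n) q) v
  vertex = chain⇒face [] (λ _ ()) (λ _ _ ())

  realisedIso : link (T (suc n) q) v ≅ K (suc (cuts g)) (blockSizes g)
  realisedIso = subst (λ g′ → link (T (suc n) q) v ≅ K (suc (cuts g′)) (blockSizes g′)) gluePattern≡g linkIso

blocksOf : ∀ {n} → Vec Bool n → Σ ℕ λ s → Vec ℕ (suc s)
blocksOf g = cuts g , blockSizes g

addHead-zero : ∀ {m} (c : Vec ℕ (suc m)) → addHead 0 c ≡ c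
addHead-zero (_ ∷ _) = refl

addHead-addHead : ∀ {m} j (c : Vec ℕ (suc m)) → addHead 1 (addHead j c) ≡ addHead (suc j) c
addHead-addHead j (_ ∷ _) = refl

blocksOf-glued : ∀ j {n} (g : Vec Bool n) → blocksOf (replicate j true ++ g) ≡ (cuts g , addHead j (blockSizes g))
blocksOf-glued zero    g = cong (cuts g ,_) (sym (addHead-zero (blockSizes g)))
blocksOf-glued (suc j) g = trans (cong (λ (s , c) → s , addHead 1 c) (blocksOf-glued j g))
                                 (cong (cuts g ,_) (addHead-addHead j (blockSizes g)))

-- Each part suc l becomes l glued steps, and consecutive parts are separated by a cut.
patternFor : ∀ {s} (lam : Vec ℕ (suc s)) → (∀ i → 1 ≤ lookup lam i) →
             Σ ℕ λ m → Σ (Vec Bool m) λ g → suc m ≡ sum lam × blocksOf g ≡ (s , lam)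
patternFor (zero  ∷ [])          pos = ⊥-elim (1+n≰n (pos zero))
patternFor (suc l ∷ [])          pos =
  l + 0 , replicate l true ++ [] , refl , trans (blocksOf-glued l []) (cong (λ z → 0 , z ∷ []) (+-comm l 1))
patternFor (zero  ∷ _ ∷ _)       pos = ⊥-elim (1+n≰n (pos zero))
patternFor (suc l ∷ l₂ ∷ rest)   pos with patternFor (l₂ ∷ rest) (pos ∘ suc)
... | m , g , size , blocks =
  l + suc m , replicate l true ++ (false ∷ g) , cong (λ z → suc (l + z)) size ,
  trans (blocksOf-glued l (false ∷ g))
        (trans (cong (λ (s , c) → suc s , (l + 1) ∷ c) blocks) (cong (λ z → _ , z ∷ l₂ ∷ rest) (+-comm l 1)))

linkOfVertex : ∀ {n} q → 1 ≤ q → (v : Vec ℕ n) → Vertex (T (suc n) q) v →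
               Σ ℕ λ s → 1 ≤ s × s ≤ q × Σ (Vec ℕ s) λ lam → IsPar (suc n) s lam × (link (T (suc n) q) v ≅ K s lam)
linkOfVertex q 1≤q v (_ , _ , _ , _ , allInW , sub) =
  suc (cuts g) , s≤s z≤n , blocks≤q (InW⇒Ascending v vInW) , sort (blockSizes g) ,
  sort-isPar (blockSizes g) (blockSizes-positive g) (sum-blockSizes g) ,
  ≅-trans linkIso (sortIso (blockSizes g))
  where
  open Around q v using (InW⇒Ascending; module LinkIso; module Cut)
  vInW = All.lookup allInW (sub (here refl))
  open CutAfter q v (proj₁ (unglued-exists q v 1≤q)) (proj₂ (unglued-exists q v 1≤q)) using (cut; blocks≤q)
  open LinkIso vInW cut using (linkIso)
  g = Cut.gluePattern cut

vertexWithLink : ∀ q s → 1 ≤ s → s ≤ q → (lam : Vec ℕ s) → ∀ k → IsPar k s lam →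
                 Σ (Vec ℕ (k ∸ 1)) λ v → Vertex (T k q) v × (link (T k q) v ≅ K s lam)
vertexWithLink q (suc s) _ s≤q lam k (_ , pos , sum≡k) with patternFor lam pos
... | m , g , size , blocks =
  subst (λ k′ → Σ (Vec ℕ (k′ ∸ 1)) λ v → Vertex (T k′ q) v × (link (T k′ q) v ≅ K (suc s) lam)) (trans size sum≡k)
        (v , vertex , subst (λ (s′ , c) → link (T (suc m) q) v ≅ K (suc s′) c) blocks realisedIso)
  where open Realise q g (subst (λ z → suc z ≤ q) (sym (cong proj₁ blocks)) s≤q)

mainTheorem3 : (k q : ℕ) → 2 ≤ k → 1 ≤ q →
    ((v : Vec ℕ (k ∸ 1)) → Vertex (T k q) v →
       Σ ℕ λ s → 1 ≤ s × s ≤ q × Σ (Vec ℕ s) λ lam →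
         IsPar k s lam × (link (T k q) v ≅ K s lam))
    × ((s : ℕ) → 1 ≤ s → s ≤ q → (lam : Vec ℕ s) → IsPar k s lam →
       Σ (Vec ℕ (k ∸ 1)) λ v → Vertex (T k q) v × (link (T k q) v ≅ K s lam))
mainTheorem3 zero    q () _
mainTheorem3 (suc k) q _  1≤q =
  linkOfVertex q 1≤q , λ s 1≤s s≤q lam isPar → vertexWithLink q s 1≤s s≤q lam (suc k) isPar
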